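{- The number of distinct maximum genus embeddings of the complete graph $K_{10}$ is at least $2^{52}\times 3^{15}\times 5^{7}\times 7^{6}$.
   Context: Embeddings are orientable cellular embeddings of the labeled graph, identified with rotation systems (a cyclic order of the incident edges at each vertex); two embeddings are distinct if their rotation systems differ. A maximum genus embedding is one in an orientable surface of genus equal to the maximum genus of the graph. -}

module Defs where

open import Data.Nat using (ℕ; zero; suc; _+_; _*_; _∸_; _^_; _≤_; _<_; _≤ᵇ_)
open import Data.Nat.DivMod using (_/_)
open import Data.Fin using (Fin; toℕ)
open import Data.Fin.Properties using (_≟_)
open import Data.Bool using (Bool; true; false; not; _∧_)
open import Data.List using (List; []; _∷_; allFin; concatMap; filterᵇ; length; upTo; map)
open import Data.Product using (_×_; _,_; ∃-syntax; Σ)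
open import Relation.Binary.PropositionalEquality using (_≡_; _≢_)
open import Relation.Nullary.Decidable using (⌊_⌋)

allᵇ : {A : Set} → (A → Bool) → List A → Bool
allᵇ p [] = true
allᵇ p (x ∷ xs) = p x ∧ allᵇ p xs

iter : {A : Set} → (A → A) → ℕ → A → A
iter f zero    x = x
iter f (suc k) x = f (iter f k x)

-- A rotation system of the labelled complete graph K_n: for every vertex v a
-- map ρ_v : Fin n → Fin n, where ρ_v u is the neighbour following u in the
-- cyclic order of the edges at v.  Normalised by ρ_v v = v, so rotation
-- systems correspond bijectively to valid such tables.
RotationSystem : ℕ → Set
RotationSystem n = Fin n → Fin n → Fin n

IsRotationAt : (n : ℕ) → Fin n → (Fin n → Fin n) → Set
IsRotationAt n v ρ =
  (ρ v ≡ v) ×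
  ((u : Fin n) → u ≢ v → ρ u ≢ v) ×
  ((u w : Fin n) → u ≢ v → w ≢ v → ∃[ k ] (k < n ∸ 1 × iter ρ k u ≡ w))

IsRotationSystem : (n : ℕ) → RotationSystem n → Set
IsRotationSystem n R = (v : Fin n) → IsRotationAt n v (R v)

Dart : ℕ → Set
Dart n = Fin n × Fin n

darts : (n : ℕ) → List (Dart n)
darts n = concatMap (λ u → map (λ v → (u , v)) (filterᵇ (λ v → not ⌊ u ≟ v ⌋) (allFin n))) (allFin n)

faceStep : {n : ℕ} → RotationSystem n → Dart n → Dart n
faceStep R (u , v) = (v , R v u)

dartKey : {n : ℕ} → Dart n → ℕ
dartKey {n} (u , v) = toℕ u * n + toℕ v

-- A dart is the representative of its face iff it has the least key in its
-- orbit (orbits have length < n*n, so n*n iterates cover the whole orbit).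
isFaceRep : {n : ℕ} → RotationSystem n → Dart n → Bool
isFaceRep {n} R d = allᵇ (λ k → dartKey d ≤ᵇ dartKey (iter (faceStep R) k d)) (upTo (n * n))

faces : (n : ℕ) → RotationSystem n → ℕ
faces n R = length (filterᵇ (isFaceRep R) (darts n))

-- genus via Euler's formula  V - E + F = 2 - 2g,  V = n, E = n(n-1)/2
genus : (n : ℕ) → RotationSystem n → ℕ
genus n R = ((n * (n ∸ 1)) / 2 + 2 ∸ n ∸ faces n R) / 2

IsMaxGenusEmbedding : (n : ℕ) → RotationSystem n → Set
IsMaxGenusEmbedding n R =
  IsRotationSystem n R × ((R' : RotationSystem n) → IsRotationSystem n R' → genus n R' ≤ genus n R)

AtLeastMaxGenusEmbeddings : ℕ → ℕ → Set
AtLeastMaxGenusEmbeddings n N =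
  Σ (Fin N → RotationSystem n) λ R →
    ((i : Fin N) → IsMaxGenusEmbedding n (R i)) ×
    ((i j : Fin N) → ((v u : Fin n) → R i v u ≡ R j v u) → i ≡ j)

-- Start from the path 0 - 1 - ... - 9, whose unique embedding has a single face, and add the
-- remaining 36 edges of K₁₀ in 18 moves, each adding two edges pq, ps at corners chosen at p, q
-- and s.  A single face, read from the chosen corner at p, meets the corners at q and s in some
-- order; inserting the two new edges at p in that same order keeps the face single.  So the final
-- embedding of K₁₀ has one face, hence genus (45 - 10 + 2 - 1)/2 = 18, which Euler's formula shows
-- to be maximal.  The corners can be chosen in deg p · deg q · deg s ways at each move, and distinct
-- choices give distinct rotation systems, since every insertion can be read back off the final
-- rotations.  Along the chosen schedule the product of these degrees exceeds 2^52·3^15·5^7·7^6.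

module Submission where

open import Defs
open import Data.Nat
  using (ℕ; zero; suc; _+_; _*_; _^_; _∸_; _≤_; _<_; _≤ᵇ_; _≡ᵇ_; z≤n; s≤s; s≤s⁻¹; _≤?_; _<?_)
import Data.Nat as ℕ
open import Data.Nat.Properties hiding (_≟_)
open import Data.List using (List; []; _∷_; _++_; _∷ʳ_; length; map; drop; filterᵇ; applyUpTo; allFin; reverse)
open import Data.Nat.ListAction using (product)
open import Data.List.Properties
  using (≡-dec; map-++; ++-assoc; ++-identityʳ; length-++; length-++-comm; ∷-injective; ∷ʳ-injective; ∷ʳ-++)
open import Data.Product using (_×_; _,_; proj₁; proj₂; ∃-syntax; swap)
open import Data.Sum using (_⊎_; inj₁; inj₂; [_,_]′)
open import Data.Bool using (Bool; true; false; T; _∧_; _∨_; if_then_else_)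
open import Data.Bool.Properties using (∧-zeroʳ)
open import Data.Unit using (⊤; tt)
open import Function using (_∘_; id; flip)
open import Relation.Nullary using (¬_; Dec; yes; no; does; contradiction)
open import Relation.Nullary.Decidable using (_⊎-dec_; _×-dec_; ¬?; map′; from-yes)
open import Relation.Binary.Definitions using (DecidableEquality)
open import Relation.Unary using (Decidable)
open import Data.List.Relation.Unary.All using (All; []; _∷_)
import Data.List.Relation.Unary.All as All
open import Data.List.Relation.Binary.Pointwise using (Pointwise; []; _∷_)
open import Relation.Binary.PropositionalEquality
open import Data.Nat.DivMod using (_%_; _/_; m%n<n; m≡m%n+[m/n]*n; m<n*o⇒m/o<n; /-monoˡ-≤)
open import Data.Nat.Tactic.RingSolver using (solve-∀)
open import Data.Fin using (Fin; toℕ; inject₁; #_)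
import Data.Fin as Fin
import Data.Fin.Properties as FinP
open import Data.Fin.Properties using (_≟_)
import Data.Product.Properties as ×

m+n≤1∧n>0⇒m≡0 : ∀ m {n} → m + n ≤ 1 → 0 < n → m ≡ 0
m+n≤1∧n>0⇒m≡0 m {n} ≤1 n>0 =
  n≤0⇒n≡0 (s≤s⁻¹ (≤-trans (subst (_≤ m + n) (+-comm m 1) (+-monoʳ-≤ m n>0)) ≤1))

>⇒≤ᵇ≡false : ∀ {m n} → n < m → (m ≤ᵇ n) ≡ false
>⇒≤ᵇ≡false {m} {n} n<m with m ≤ᵇ n in eq
... | false = refl
... | true  = contradiction (≤ᵇ⇒≤ m n (subst T (sym eq) tt)) (<⇒≱ n<m)

allᵇ-applyUpTo≡false : ∀ (f : ℕ → Bool) g {m k} → k < m → f (g k) ≡ false →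
                       allᵇ f (applyUpTo g m) ≡ false
allᵇ-applyUpTo≡false f g {suc m} {zero}  _        fk rewrite fk = refl
allᵇ-applyUpTo≡false f g {suc m} {suc k} (s≤s k<) fk =
  trans (cong (f (g 0) ∧_) (allᵇ-applyUpTo≡false f (g ∘ suc) k< fk)) (∧-zeroʳ (f (g 0)))

filterᵇ-none : ∀ {A : Set} (p : A → Bool) {xs} → All (λ x → p x ≡ false) xs → filterᵇ p xs ≡ []
filterᵇ-none p []         = refl
filterᵇ-none p (px ∷ pxs) rewrite px = filterᵇ-none p pxs

length-filterᵇ≤1 : ∀ {A : Set} (p : A → Bool) x xs → All (λ y → p y ≡ false) xs →
                   length (filterᵇ p (x ∷ xs)) ≤ 1
length-filterᵇ≤1 p x xs none with p x
... | true  rewrite filterᵇ-none p none = ≤-refl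
... | false rewrite filterᵇ-none p none = z≤n

-- Paths and cycles of a map

module _ {A : Set} where

  Path : (A → A) → A → List A → A → Set
  Path f x []       y = f x ≡ y
  Path f x (z ∷ zs) y = f x ≡ z × Path f z zs y

  Cycle : (A → A) → List A → Set
  Cycle f []       = ⊤
  Cycle f (x ∷ xs) = Path f x xs x

  Path-++⁻ : ∀ {f x y m} (P : List A) {Q} → Path f x (P ++ m ∷ Q) y → Path f x P m × Path f m Q y
  Path-++⁻ []      (e , r) = e , r
  Path-++⁻ (z ∷ P) (e , r) = let (r₁ , r₂) = Path-++⁻ P r in (e , r₁) , r₂

  Path-++⁺ : ∀ {f x y m} (P : List A) {Q} → Path f x P m → Path f m Q y → Path f x (P ++ m ∷ Q) y
  Path-++⁺ []      e        r  = e , r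
  Path-++⁺ (z ∷ P) (e , r₁) r₂ = e , Path-++⁺ P r₁ r₂

  Cycle-rotate : ∀ {f} (P : List A) x Q → Cycle f (P ++ x ∷ Q) → Path f x (Q ++ P) x
  Cycle-rotate []      x Q c rewrite ++-identityʳ Q = c
  Cycle-rotate (a ∷ P) x Q c = let (r₁ , r₂) = Path-++⁻ P c in Path-++⁺ Q r₂ r₁

  Cycle-unrotate : ∀ {f} (P : List A) x Q → Path f x (Q ++ P) x → Cycle f (P ++ x ∷ Q)
  Cycle-unrotate []      x Q c rewrite ++-identityʳ Q = c
  Cycle-unrotate (a ∷ P) x Q c = let (r₁ , r₂) = Path-++⁻ Q c in Path-++⁺ P r₂ r₁

  iter-suc : ∀ (f : A → A) n x → iter f (suc n) x ≡ iter f n (f x)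
  iter-suc f zero    x = refl
  iter-suc f (suc n) x = cong f (iter-suc f n x)

  Path⇒iter : ∀ {f x y} (P : List A) → Path f x P y → iter f (suc (length P)) x ≡ y
  Path⇒iter     []      e       = e
  Path⇒iter {f} (z ∷ P) (e , r) = begin
    iter f (suc (suc (length P))) _  ≡⟨ iter-suc f (suc (length P)) _ ⟩
    iter f (suc (length P)) (f _)    ≡⟨ cong (iter f (suc (length P))) e ⟩
    iter f (suc (length P)) z        ≡⟨ Path⇒iter P r ⟩
    _                                ∎
    where open ≡-Reasoning

  orbit : (A → A) → A → ℕ → List A
  orbit f x zero    = []
  orbit f x (suc n) = x ∷ orbit f (f x) n

  Path⇒orbit : ∀ {f x y} (P : List A) → Path f x P y → x ∷ P ≡ orbit f x (suc (length P))
  Path⇒orbit         []      e          = refl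
  Path⇒orbit {x = x} (z ∷ P) (refl , r) = cong (x ∷_) (Path⇒orbit P r)

  orbit-cong : ∀ {f g : A → A} x n → (∀ u → f u ≡ g u) → orbit f x n ≡ orbit g x n
  orbit-cong x zero    h = refl
  orbit-cong x (suc n) h rewrite h x = cong (x ∷_) (orbit-cong _ n h)

  ++-cancelˡ-length : ∀ (xs xs′ : List A) {ys ys′} → length xs ≡ length xs′ →
                      xs ++ ys ≡ xs′ ++ ys′ → ys ≡ ys′
  ++-cancelˡ-length []       []         _   eq = eq
  ++-cancelˡ-length (x ∷ xs) (x′ ∷ xs′) len eq =
    ++-cancelˡ-length xs xs′ (suc-injective len) (proj₂ (∷-injective eq))

-- Counting occurrences

module Counting {A : Set} (_≟_ : DecidableEquality A) where
  δ : A → A → ℕ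
  δ x y with x ≟ y
  ... | yes _ = 1
  ... | no  _ = 0

  δ-refl : ∀ x → δ x x ≡ 1
  δ-refl x with x ≟ x
  ... | yes _   = refl
  ... | no  x≢x = contradiction refl x≢x

  δ-≢ : ∀ {x y} → x ≢ y → δ x y ≡ 0
  δ-≢ {x} {y} x≢y with x ≟ y
  ... | yes x≡y = contradiction x≡y x≢y
  ... | no  _   = refl

  count : A → List A → ℕ
  count x []       = 0
  count x (y ∷ ys) = δ x y + count x ys

  count-++ : ∀ x (P Q : List A) → count x (P ++ Q) ≡ count x P + count x Q
  count-++ x []      Q = refl
  count-++ x (y ∷ P) Q = trans (cong (δ x y +_) (count-++ x P Q)) (sym (+-assoc (δ x y) _ _))

  count-++-comm : ∀ x (P Q : List A) → count x (P ++ Q) ≡ count x (Q ++ P)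
  count-++-comm x P Q = trans (count-++ x P Q) (trans (+-comm (count x P) _) (sym (count-++ x Q P)))

  infix 4 _∈_ _∉_

  record _∈_ (x : A) (xs : List A) : Set where
    constructor occurs
    field count-pos : 0 < count x xs

  open _∈_ public

  record _∉_ (x : A) (xs : List A) : Set where
    constructor absent
    field count≡0 : count x xs ≡ 0

  open _∉_ public

  ∈-head : ∀ x xs → x ∈ x ∷ xs
  ∈-head x xs = occurs (subst (λ n → 0 < n + count x xs) (sym (δ-refl x)) (s≤s z≤n))

  ∈-tail : ∀ {x} y {xs} → x ∈ xs → x ∈ y ∷ xs
  ∈-tail {x} y {xs} (occurs pos) = occurs (≤-trans pos (m≤n+m (count x xs) (δ x y)))

  ∈-++⁺ˡ : ∀ {x} P {Q} → x ∈ P → x ∈ P ++ Q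
  ∈-++⁺ˡ {x} P {Q} (occurs pos) =
    occurs (subst (0 <_) (sym (count-++ x P Q)) (≤-trans pos (m≤m+n _ _)))

  ∈-++⁺ʳ : ∀ {x} P {Q} → x ∈ Q → x ∈ P ++ Q
  ∈-++⁺ʳ {x} P {Q} (occurs pos) =
    occurs (subst (0 <_) (sym (count-++ x P Q)) (≤-trans pos (m≤n+m _ _)))

  ∈-++⁻ : ∀ {x} P {Q} → x ∈ P ++ Q → x ∈ P ⊎ x ∈ Q
  ∈-++⁻ {x} P {Q} (occurs pos) with count x P in eq
  ... | zero  = inj₂ (occurs (subst (0 <_) (trans (count-++ x P Q) (cong (_+ count x Q) eq)) pos))
  ... | suc _ = inj₁ (occurs (subst (0 <_) (sym eq) (s≤s z≤n)))

  ∈-∷⁻ : ∀ {x y xs} → x ∈ y ∷ xs → x ≡ y ⊎ x ∈ xs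
  ∈-∷⁻ {x} {y} (occurs pos) with x ≟ y
  ... | yes x≡y = inj₁ x≡y
  ... | no  _   = inj₂ (occurs pos)

  ∈∧∉⇒≢ : ∀ {x y xs} → x ∈ xs → y ∉ xs → x ≢ y
  ∈∧∉⇒≢ (occurs pos) (absent none) refl rewrite none = n≮0 pos

  δ≡0⇒≢ : ∀ {x y} → δ x y ≡ 0 → x ≢ y
  δ≡0⇒≢ {x} δ≡0 refl = 1≢0 (trans (sym (δ-refl x)) δ≡0)
    where
    1≢0 : 1 ≢ 0
    1≢0 ()

  ∈⇒nonempty : ∀ {x xs} → x ∈ xs → 0 < length xs
  ∈⇒nonempty {xs = _ ∷ _} _ = s≤s z≤n

  ∈-All : ∀ {P : A → Set} {x xs} → All P xs → x ∈ xs → P x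
  ∈-All (Px ∷ Pxs) x∈ with ∈-∷⁻ x∈
  ... | inj₁ refl = Px
  ... | inj₂ x∈xs = ∈-All Pxs x∈xs

  ∈-split : ∀ {x xs} → x ∈ xs → ∃[ P ] ∃[ Q ] xs ≡ P ++ x ∷ Q
  ∈-split {xs = y ∷ ys} x∈ with ∈-∷⁻ x∈
  ... | inj₁ refl = [] , ys , refl
  ... | inj₂ x∈ys = let (P , Q , eq) = ∈-split x∈ys in y ∷ P , Q , cong (y ∷_) eq

  ∈-rotate : ∀ {z} P c Q → z ∈ Q ++ P → z ∈ P ++ c ∷ Q
  ∈-rotate {z} P c Q (occurs pos) =
    occurs (subst (0 <_) (sym (count-++-comm z P (c ∷ Q))) (≤-trans pos (m≤n+m _ (δ z c))))

  ∉-tail : ∀ {z} y xs → z ∉ y ∷ xs → z ∉ xs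
  ∉-tail {z} y xs (absent none) = absent (m+n≡0⇒n≡0 (δ z y) none)

  ∉-++ˡ : ∀ {z} P {Q} → z ∉ P ++ Q → z ∉ P
  ∉-++ˡ {z} P {Q} (absent none) = absent (m+n≡0⇒m≡0 (count z P) (trans (sym (count-++ z P Q)) none))

  ∉-∷ : ∀ {x y xs} → x ≢ y → x ∉ xs → x ∉ y ∷ xs
  ∉-∷ {xs = xs} x≢y (absent none) = absent (trans (cong (_+ _) (δ-≢ x≢y)) none)

  Disjoint : List A → List A → Set
  Disjoint zs xs = ∀ {z} → z ∈ zs → z ∉ xs

  record NoDuplicates (xs : List A) : Set where
    constructor nodup
    field count≤1 : ∀ x → count x xs ≤ 1

  open NoDuplicates public

  NoDuplicates-∷ : ∀ {x xs} → x ∉ xs → NoDuplicates xs → NoDuplicates (x ∷ xs)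
  NoDuplicates-∷ {x} {xs} (absent none) (nodup nd) = nodup bound
    where
    bound : ∀ z → count z (x ∷ xs) ≤ 1
    bound z with z ≟ x
    ... | yes refl rewrite none = ≤-refl
    ... | no  _    = nd z

  NoDuplicates-++ : ∀ {P Q} → NoDuplicates P → NoDuplicates Q → Disjoint P Q → NoDuplicates (P ++ Q)
  NoDuplicates-++ {P} {Q} (nodup ndP) (nodup ndQ) dis = nodup λ z → subst (_≤ 1) (sym (count-++ z P Q)) (bound z)
    where
    bound : ∀ z → count z P + count z Q ≤ 1
    bound z with count z P in eq
    ... | zero  = ndQ z
    ... | suc _ rewrite count≡0 (dis (occurs (subst (0 <_) (sym eq) (s≤s z≤n)))) =
      subst (_≤ 1) (sym (+-identityʳ _)) (subst (_≤ 1) eq (ndP z))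

  unique⇒∉-rest : ∀ P c Q → count c (P ++ c ∷ Q) ≤ 1 → c ∉ Q ++ P
  unique⇒∉-rest P c Q ≤1 =
    absent (n≤0⇒n≡0 (s≤s⁻¹ (subst (_≤ 1) count≡ ≤1)))
    where
    count≡ : count c (P ++ c ∷ Q) ≡ 1 + count c (Q ++ P)
    count≡ = trans (count-++-comm c P (c ∷ Q)) (cong (_+ count c (Q ++ P)) (δ-refl c))

  ∈? : ∀ x xs → Dec (x ∈ xs)
  ∈? x xs = map′ occurs count-pos (0 <? count x xs)

  ∉? : ∀ x xs → Dec (x ∉ xs)
  ∉? x xs = map′ absent count≡0 (count x xs ℕ.≟ 0)

  Path-cong : ∀ {f g : A → A} {x x′ y} P → (∀ z → z ∈ P → g z ≡ f z) →
              g x′ ≡ f x → Path f x P y → Path g x′ P y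
  Path-cong []      agree e r        = trans e r
  Path-cong (z ∷ P) agree e (r₁ , r₂) =
    trans e r₁ , Path-cong P (λ w w∈P → agree w (∈-tail z w∈P)) (agree z (∈-head z P)) r₂

  Path⇒next : ∀ {f x y} M → Path f x M y → f x ∈ M ⊎ f x ≡ y
  Path⇒next []      e       = inj₂ e
  Path⇒next (z ∷ M) (e , _) = inj₁ (subst (_∈ z ∷ M) (sym e) (∈-head z M))

  Path-reach : ∀ {f x y z} M → Path f x M z → y ∈ M → ∃[ k ] (k < length M × iter f (suc k) x ≡ y)
  Path-reach M path y∈M with ∈-split y∈M
  ... | M₁ , M₂ , refl =
    length M₁ ,
    subst (length M₁ <_) (sym (length-++ M₁)) (m<m+n (length M₁) (s≤s z≤n)) ,
    Path⇒iter M₁ (proj₁ (Path-++⁻ M₁ path))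

  splitWhen : {P : A → Set} → Decidable P → List A → List A × List A
  splitWhen P? []       = [] , []
  splitWhen P? (y ∷ ys) with does (P? y)
  ... | true  = [] , y ∷ ys
  ... | false = y ∷ proj₁ (splitWhen P? ys) , proj₂ (splitWhen P? ys)

  splitWhen-spec : ∀ {P : A → Set} (P? : Decidable P) xs {x} → x ∈ xs → P x →
    ∃[ m ] ∃[ R ] (proj₂ (splitWhen P? xs) ≡ m ∷ R × xs ≡ proj₁ (splitWhen P? xs) ++ m ∷ R ×
                   P m × All (¬_ ∘ P) (proj₁ (splitWhen P? xs)))
  splitWhen-spec P? (y ∷ ys) x∈ Px with P? y
  ... | yes Py = y , ys , refl , refl , Py , []
  ... | no ¬Py with ∈-∷⁻ x∈
  ...   | inj₁ refl = contradiction Px ¬Py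
  ...   | inj₂ x∈ys =
    let (m , R , e₁ , e₂ , Pm , none) = splitWhen-spec P? ys x∈ys Px
    in m , R , e₁ , cong (y ∷_) e₂ , Pm , ¬Py ∷ none

  around : A → List A → List A × List A
  around x xs = let (P , Q) = splitWhen (_≟ x) xs in P , drop 1 Q

  around-spec : ∀ {x} xs → x ∈ xs → xs ≡ proj₁ (around x xs) ++ x ∷ proj₂ (around x xs)
  around-spec {x} xs x∈ with splitWhen-spec (_≟ x) xs x∈ refl
  ... | m , R , e₁ , e₂ , refl , _ rewrite e₁ = e₂

  rotateAfter : A → List A → List A
  rotateAfter x xs = proj₂ (around x xs) ++ proj₁ (around x xs)

  rotateAfter-spec : ∀ {x} xs → x ∈ xs →
                     ∃[ P ] ∃[ Q ] (xs ≡ P ++ x ∷ Q × rotateAfter x xs ≡ Q ++ P)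
  rotateAfter-spec xs x∈ = _ , _ , around-spec xs x∈ , refl

  module _ {x : A} {xs : List A} (x∈xs : x ∈ xs) where

    count-rotateAfter : ∀ z → count z xs ≡ δ z x + count z (rotateAfter x xs)
    count-rotateAfter z with rotateAfter-spec xs x∈xs
    ... | P , Q , refl , eq rewrite eq = count-++-comm z P (x ∷ Q)

    length-rotateAfter : length xs ≡ suc (length (rotateAfter x xs))
    length-rotateAfter with rotateAfter-spec xs x∈xs
    ... | P , Q , refl , eq rewrite eq = length-++-comm P (x ∷ Q)

    Cycle-rotateAfter : ∀ {f} → Cycle f xs → Path f x (rotateAfter x xs) x
    Cycle-rotateAfter c with rotateAfter-spec xs x∈xs
    ... | P , Q , refl , eq rewrite eq = Cycle-rotate P x Q c

    ∈-rotateAfter⁻ : ∀ {z} → z ∈ rotateAfter x xs → z ∈ xs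
    ∈-rotateAfter⁻ {z} (occurs pos) =
      occurs (subst (0 <_) (sym (count-rotateAfter z)) (≤-trans pos (m≤n+m _ (δ z x))))

    ∈-rotateAfter⁺ : ∀ {z} → z ∈ xs → z ≢ x → z ∈ rotateAfter x xs
    ∈-rotateAfter⁺ {z} (occurs pos) z≢x =
      occurs (subst (0 <_) (trans (count-rotateAfter z) (cong (_+ count z (rotateAfter x xs)) (δ-≢ z≢x))) pos)

  Cycle-closed : ∀ {f x} xs → Cycle f xs → x ∈ xs → f x ∈ xs
  Cycle-closed {f} {x} xs c x∈ with Path⇒next _ (Cycle-rotateAfter x∈ c)
  ... | inj₁ fx∈ = ∈-rotateAfter⁻ x∈ fx∈
  ... | inj₂ fx≡x = subst (_∈ xs) (sym fx≡x) x∈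

  Cycle-reach : ∀ {f x y} xs → Cycle f xs → x ∈ xs → y ∈ xs →
                ∃[ k ] (k < length xs × iter f k x ≡ y)
  Cycle-reach {x = x} {y} xs c x∈ y∈ with y ≟ x
  ... | yes refl = 0 , ∈⇒nonempty x∈ , refl
  ... | no y≢x =
    let (k , k< , reach) = Path-reach _ (Cycle-rotateAfter x∈ c) (∈-rotateAfter⁺ x∈ y∈ y≢x)
    in suc k , subst (suc k <_) (sym (length-rotateAfter x∈)) (s≤s k<) , reach

  nth : A → List A → ℕ → A
  nth d []       i       = d
  nth d (x ∷ xs) zero    = x
  nth d (x ∷ xs) (suc i) = nth d xs i

  insertAfter : ℕ → List A → List A → List A
  insertAfter i       ys []       = ys
  insertAfter zero    ys (x ∷ xs) = x ∷ ys ++ xs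
  insertAfter (suc i) ys (x ∷ xs) = x ∷ insertAfter i ys xs

  insertAfter-spec : ∀ d ys xs i → i < length xs →
    ∃[ P ] ∃[ Q ] (xs ≡ P ++ nth d xs i ∷ Q × insertAfter i ys xs ≡ P ++ nth d xs i ∷ ys ++ Q ×
                   length P ≡ i)
  insertAfter-spec d ys (x ∷ xs) zero    _ = [] , xs , refl , refl , refl
  insertAfter-spec d ys (x ∷ xs) (suc i) (s≤s i<) =
    let (P , Q , e₁ , e₂ , e₃) = insertAfter-spec d ys xs i i<
    in x ∷ P , Q , cong (x ∷_) e₁ , cong (x ∷_) e₂ , cong suc e₃

  nth∈ : ∀ d xs i → i < length xs → nth d xs i ∈ xs
  nth∈ d xs i i< with insertAfter-spec d [] xs i i<
  ... | P , Q , eq , _ = subst (nth d xs i ∈_) (sym eq) (∈-++⁺ʳ P (∈-head _ Q))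

  nth-insertAfter : ∀ d i ys xs → i < length xs → nth d (insertAfter i ys xs) i ≡ nth d xs i
  nth-insertAfter d zero    ys (x ∷ xs) _        = refl
  nth-insertAfter d (suc i) ys (x ∷ xs) (s≤s i<) = nth-insertAfter d i ys xs i<

  count-insertAfter : ∀ x i ys xs → count x (insertAfter i ys xs) ≡ count x xs + count x ys
  count-insertAfter x i       ys []       = refl
  count-insertAfter x zero    ys (y ∷ xs) rewrite count-++ x ys xs =
    trans (cong (δ x y +_) (+-comm (count x ys) _)) (sym (+-assoc (δ x y) _ _))
  count-insertAfter x (suc i) ys (y ∷ xs) rewrite count-insertAfter x i ys xs = sym (+-assoc (δ x y) _ _)

  length-insertAfter : ∀ i ys xs → length (insertAfter i ys xs) ≡ length xs + length ys
  length-insertAfter i       ys []       = refl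
  length-insertAfter zero    ys (y ∷ xs) = cong suc (trans (length-++ ys) (+-comm (length ys) _))
  length-insertAfter (suc i) ys (y ∷ xs) = cong suc (length-insertAfter i ys xs)

  insertAfter-head : ∀ i ys h t → ∃[ t′ ] insertAfter i ys (h ∷ t) ≡ h ∷ t′
  insertAfter-head zero    ys h t = ys ++ t , refl
  insertAfter-head (suc i) ys h t = insertAfter i ys t , refl

  insertAfter-∷ : ∀ i y ys xs → i < length xs →
                  insertAfter i (y ∷ ys) xs ≡ insertAfter i (y ∷ []) (insertAfter i ys xs)
  insertAfter-∷ zero    y ys (x ∷ xs) _        = refl
  insertAfter-∷ (suc i) y ys (x ∷ xs) (s≤s i<) = cong (x ∷_) (insertAfter-∷ i y ys xs i<)

  NoDuplicates-insertAfter : ∀ i y xs → NoDuplicates xs → y ∉ xs →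
                             NoDuplicates (insertAfter i (y ∷ []) xs)
  NoDuplicates-insertAfter i y xs (nodup nd) (absent none) = nodup λ x →
    subst (_≤ 1) (sym (count-insertAfter x i (y ∷ []) xs)) (bound x)
    where
    bound : ∀ x → count x xs + (δ x y + 0) ≤ 1
    bound x with x ≟ y
    ... | yes refl rewrite none = ≤-refl
    ... | no  _    = subst (_≤ 1) (sym (+-identityʳ (count x xs))) (nd x)

  ++-∷-cancel : ∀ zs P P′ {x x′ Q Q′} → Disjoint zs P → Disjoint zs P′ → x ∈ zs → x′ ∈ zs →
                P ++ x ∷ Q ≡ P′ ++ x′ ∷ Q′ → P ≡ P′ × x ∷ Q ≡ x′ ∷ Q′
  ++-∷-cancel zs []      []       _  _  _  _   eq = refl , eq
  ++-∷-cancel zs []      (w ∷ P′) _  d′ x∈ _   eq with ∷-injective eq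
  ... | refl , _ = contradiction refl (∈∧∉⇒≢ (∈-head w P′) (d′ x∈))
  ++-∷-cancel zs (w ∷ P) []       d  _  _  x′∈ eq with ∷-injective eq
  ... | refl , _ = contradiction refl (∈∧∉⇒≢ (∈-head w P) (d x′∈))
  ++-∷-cancel zs (w ∷ P) (w′ ∷ P′) d d′ x∈ x′∈ eq with ∷-injective eq
  ... | refl , eq′ =
    let (eP , eQ) = ++-∷-cancel zs P P′ (∉-tail w P ∘ d) (∉-tail w′ P′ ∘ d′) x∈ x′∈ eq′
    in cong (w ∷_) eP , eQ

  insertAfter-injective : ∀ zs {i i′ xs xs′ y y′ ys ys′} →
    i < length xs → i′ < length xs′ → Disjoint zs xs → Disjoint zs xs′ → y ∈ zs → y′ ∈ zs →
    length ys ≡ length ys′ → insertAfter i (y ∷ ys) xs ≡ insertAfter i′ (y′ ∷ ys′) xs′ →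
    i ≡ i′ × xs ≡ xs′
  insertAfter-injective zs {i} {i′} {xs} {xs′} {y} {y′} {ys} {ys′} i< i′< dis dis′ y∈ y′∈ len eq
    with insertAfter-spec y (y ∷ ys) xs i i< | insertAfter-spec y′ (y′ ∷ ys′) xs′ i′ i′<
  ... | P , Q , ex , e , refl | P′ , Q′ , ex′ , e′ , refl =
    let c = nth y xs i ; c′ = nth y′ xs′ i′
        (ePc , eR) = ++-∷-cancel zs (P ∷ʳ c) (P′ ∷ʳ c′)
                       (∉-++ˡ (P ∷ʳ c) ∘ subst (_ ∉_) (trans ex (sym (∷ʳ-++ P c Q))) ∘ dis)
                       (∉-++ˡ (P′ ∷ʳ c′) ∘ subst (_ ∉_) (trans ex′ (sym (∷ʳ-++ P′ c′ Q′))) ∘ dis′)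
                       y∈ y′∈
                       (begin
                         P ∷ʳ c ++ y ∷ ys ++ Q     ≡⟨ ∷ʳ-++ P c _ ⟩
                         P ++ c ∷ y ∷ ys ++ Q      ≡⟨ trans (sym e) (trans eq e′) ⟩
                         P′ ++ c′ ∷ y′ ∷ ys′ ++ Q′ ≡⟨ sym (∷ʳ-++ P′ c′ _) ⟩
                         P′ ∷ʳ c′ ++ y′ ∷ ys′ ++ Q′ ∎)
        (eP , ec) = ∷ʳ-injective P P′ ePc
        eQ = ++-cancelˡ-length (y ∷ ys) (y′ ∷ ys′) (cong suc len) eR
    in cong length eP ,
       (begin
         xs             ≡⟨ ex ⟩
         P ++ c ∷ Q     ≡⟨ cong₂ (λ R x → R ++ x ∷ Q) eP ec ⟩
         P′ ++ c′ ∷ Q   ≡⟨ cong (λ R → P′ ++ c′ ∷ R) eQ ⟩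
         P′ ++ c′ ∷ Q′  ≡⟨ sym ex′ ⟩
         xs′            ∎)
    where open ≡-Reasoning

  update : {B : Set} → (A → B) → A → B → A → B
  update f a b x with x ≟ a
  ... | yes _ = b
  ... | no  _ = f x

  update-hit : ∀ {B : Set} (f : A → B) a b → update f a b a ≡ b
  update-hit f a b with a ≟ a
  ... | yes _   = refl
  ... | no  a≢a = contradiction refl a≢a

  update-miss : ∀ {B : Set} (f : A → B) {a} b {x} → x ≢ a → update f a b x ≡ f x
  update-miss f {a} b {x} x≢a with x ≟ a
  ... | yes x≡a = contradiction x≡a x≢a
  ... | no  _   = refl

  update₃ : {B : Set} → (A → B) → A → B → A → B → A → B → A → B
  update₃ f a x b y c z = update (update (update f c z) b y) a x

  module _ {B : Set} (f : A → B) (a b c : A) (x y z : B) where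

    update₃-a : update₃ f a x b y c z a ≡ x
    update₃-a = update-hit _ a x

    update₃-b : b ≢ a → update₃ f a x b y c z b ≡ y
    update₃-b b≢a = trans (update-miss _ x b≢a) (update-hit _ b y)

    update₃-c : c ≢ a → c ≢ b → update₃ f a x b y c z c ≡ z
    update₃-c c≢a c≢b = trans (update-miss _ x c≢a) (trans (update-miss _ y c≢b) (update-hit f c z))

    update₃-other : ∀ {v} → v ≢ a → v ≢ b → v ≢ c → update₃ f a x b y c z v ≡ f v
    update₃-other v≢a v≢b v≢c =
      trans (update-miss _ x v≢a) (trans (update-miss _ y v≢b) (update-miss f z v≢c))

  splice : (A → A) → A → A → A → A
  splice f c y = update (update f y (f c)) c y

  splice-at : ∀ f c y → splice f c y c ≡ y
  splice-at f c y = update-hit _ c y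

  splice-new : ∀ f {c y} → y ≢ c → splice f c y y ≡ f c
  splice-new f {c} {y} y≢c = trans (update-miss _ y y≢c) (update-hit f y (f c))

  splice-other : ∀ f {c y x} → x ≢ c → x ≢ y → splice f c y x ≡ f x
  splice-other f {c} {y} x≢c x≢y = trans (update-miss _ y x≢c) (update-miss f (f c) x≢y)

  Cycle-insert : ∀ {f g} P c Q ys → Cycle f (P ++ c ∷ Q) → (∀ z → z ∈ Q ++ P → g z ≡ f z) →
                 Path g c ys (f c) → Cycle g (P ++ c ∷ ys ++ Q)
  Cycle-insert {f} {g} P c Q ys cyc agree path =
    Cycle-unrotate P c (ys ++ Q)
      (subst (λ M → Path g c M c) (sym (++-assoc ys Q P)) (extend (Q ++ P) (Cycle-rotate P c Q cyc) agree))
    where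
    extend : ∀ M → Path f c M c → (∀ z → z ∈ M → g z ≡ f z) → Path g c (ys ++ M) c
    extend []      e       _   rewrite ++-identityʳ ys = subst (Path g c ys) e path
    extend (m ∷ M) (e , r) agr =
      Path-++⁺ ys (subst (Path g c ys) e path)
        (Path-cong M (λ z z∈ → agr z (∈-tail m z∈)) (agr m (∈-head m M)) r)

  Cycle-splice : ∀ {f} d i y xs → i < length xs → NoDuplicates xs → y ∉ xs → Cycle f xs →
                 Cycle (splice f (nth d xs i) y) (insertAfter i (y ∷ []) xs)
  Cycle-splice {f} d i y xs i< nd y∉ cyc with insertAfter-spec d (y ∷ []) xs i i<
  ... | P , Q , ex , ei , _ rewrite ei =
    Cycle-insert P c Q (y ∷ []) (subst (Cycle f) ex cyc) agree (splice-at f c y , splice-new f y≢c)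
    where
    c = nth d xs i
    c∉rest : c ∉ Q ++ P
    c∉rest = unique⇒∉-rest P c Q (subst (λ L → count c L ≤ 1) ex (count≤1 nd c))
    y≢c : y ≢ c
    y≢c = ∈∧∉⇒≢ (nth∈ d xs i i<) y∉ ∘ sym
    agree : ∀ z → z ∈ Q ++ P → splice f c y z ≡ f z
    agree z z∈ = splice-other f (∈∧∉⇒≢ z∈ c∉rest)
                   (∈∧∉⇒≢ (subst (z ∈_) (sym ex) (∈-rotate P c Q z∈)) y∉)

  path? : ∀ f x xs y → Dec (Path f x xs y)
  path? f x []       y = f x ≟ y
  path? f x (z ∷ zs) y = f x ≟ z ×-dec path? f z zs y

  cycle? : ∀ f xs → Dec (Cycle f xs)
  cycle? f []       = yes tt
  cycle? f (x ∷ xs) = path? f x xs x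

  -- Junk value: x itself when x is not listed.
  cyclicSucc : List A → A → A
  cyclicSucc []       x = x
  cyclicSucc (y ∷ ys) x = go y ys
    where
    go : A → List A → A
    go z []       = if does (x ≟ z) then y else x
    go z (w ∷ ws) = if does (x ≟ z) then w else go w ws

-- One-face embeddings

module OneFaceEmbeddings (n : ℕ) where

  open Counting (_≟_ {n}) public

  _≟ᵈ_ : DecidableEquality (Dart n)
  _≟ᵈ_ = ×.≡-dec _≟_ _≟_

  module D = Counting _≟ᵈ_

  δ-dart : ∀ a b c d → D.δ (a , b) (c , d) ≡ δ a c * δ b d
  δ-dart a b c d = cases (a ≟ c) (b ≟ d)
    where
    cases : Dec (a ≡ c) → Dec (b ≡ d) → D.δ (a , b) (c , d) ≡ δ a c * δ b d
    cases (yes refl) (yes refl) = trans (D.δ-refl (a , b)) (sym (cong₂ _*_ (δ-refl a) (δ-refl b)))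
    cases (no a≢c)   _          = trans (D.δ-≢ (a≢c ∘ cong proj₁)) (sym (cong (_* δ b d) (δ-≢ a≢c)))
    cases (yes _)    (no b≢d)   =
      trans (D.δ-≢ (b≢d ∘ cong proj₂)) (sym (trans (cong (δ a c *_) (δ-≢ b≢d)) (*-zeroʳ (δ a c))))

  record Embedding : Set where
    constructor embedding
    field
      ρ     : RotationSystem n
      order : Fin n → List (Fin n)
      face  : List (Dart n)

  degree : List (Dart n) → Fin n → ℕ
  degree E v = count v (map proj₂ E)

  -- head v fixes where the rotation list order v starts, so that ρ determines order.
  record OneFaceEmbedding (head : Fin n → Fin n) (E : List (Dart n)) (S : Embedding) : Set where
    open Embedding S
    field
      ρ-cycle      : ∀ v → Cycle (ρ v) (order v)
      ρ-fix        : ∀ v → ρ v v ≡ v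
      order-head   : ∀ v → ∃[ t ] order v ≡ head v ∷ t
      order-count  : ∀ v u → count u (order v) ≡ D.count (u , v) E
      order-length : ∀ v → length (order v) ≡ degree E v
      face-cycle   : Cycle (faceStep ρ) face
      face-count   : ∀ z → D.count z face ≡ D.count z E
      face-length  : length face ≡ length E
      E-simple     : D.NoDuplicates E
      E-loopless   : ∀ v → (v , v) D.∉ E

  arm : Fin n → Fin n → List (Dart n)
  arm p q = (p , q) ∷ (q , p) ∷ []

  newDarts : Fin n → Fin n → Fin n → List (Dart n)
  newDarts p q s = arm p q ++ arm p s

  degree-++ : ∀ A B v → degree (A ++ B) v ≡ degree A v + degree B v
  degree-++ A B v = trans (cong (count v) (map-++ proj₂ A B)) (count-++ v (map proj₂ A) (map proj₂ B))

  module OneFaceProperties {head E S} (I : OneFaceEmbedding head E S) where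
    open Embedding S
    open OneFaceEmbedding I

    order-nodup : ∀ v → NoDuplicates (order v)
    order-nodup v = nodup λ u → subst (_≤ 1) (sym (order-count v u)) (D.count≤1 E-simple (u , v))

    ∉order : ∀ u v → (u , v) D.∉ E → u ∉ order v
    ∉order u v (absent none) = absent (trans (order-count v u) none)

    ∈order⇒≢ : ∀ {u v} w → u ∈ order v → (w , v) D.∉ E → u ≢ w
    ∈order⇒≢ {v = v} w u∈ w∉ = ∈∧∉⇒≢ u∈ (∉order w v w∉)

    <length : ∀ {m v} → m < degree E v → m < length (order v)
    <length {m} {v} = subst (m <_) (sym (order-length v))

    count-order≡count-face : ∀ u v → count u (order v) ≡ D.count (u , v) face
    count-order≡count-face u v = trans (order-count v u) (sym (face-count (u , v)))

    ∈order⇒∈face : ∀ {u v} → u ∈ order v → (u , v) D.∈ face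
    ∈order⇒∈face {u} {v} (occurs pos) = D.occurs (subst (0 <_) (count-order≡count-face u v) pos)

    ∈face⇒∈order : ∀ {u v} → (u , v) D.∈ face → u ∈ order v
    ∈face⇒∈order {u} {v} (D.occurs pos) = occurs (subst (0 <_) (sym (count-order≡count-face u v)) pos)

    corner∈face : ∀ {m v} → m < degree E v → (nth v (order v) m , v) D.∈ face
    corner∈face {m} {v} m< = ∈order⇒∈face (nth∈ v (order v) m (<length m<))

    order≡orbit : ∀ v → order v ≡ orbit (ρ v) (head v) (degree E v)
    order≡orbit v with order-head v
    ... | t , eq = begin
      order v                                     ≡⟨ eq ⟩
      head v ∷ t                                  ≡⟨ Path⇒orbit t (subst (Cycle (ρ v)) eq (ρ-cycle v)) ⟩
      orbit (ρ v) (head v) (length (head v ∷ t))  ≡⟨ cong (orbit (ρ v) (head v)) length≡ ⟩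
      orbit (ρ v) (head v) (degree E v)           ∎
      where
      open ≡-Reasoning
      length≡ : length (head v ∷ t) ≡ degree E v
      length≡ = trans (cong length (sym eq)) (order-length v)

  order-determined : ∀ {head E S S′} → OneFaceEmbedding head E S → OneFaceEmbedding head E S′ →
                     (∀ v u → Embedding.ρ S v u ≡ Embedding.ρ S′ v u) →
                     ∀ v → Embedding.order S v ≡ Embedding.order S′ v
  order-determined I I′ same v =
    trans (OneFaceProperties.order≡orbit I v)
      (trans (orbit-cong _ _ (same v)) (sym (OneFaceProperties.order≡orbit I′ v)))

  -- If the old face reads (c,p) Y (d,q) Z (e,s) T cyclically, the new face is face′ Y Z T.
  module Attach (S : Embedding) (p : Fin n) (i : ℕ) (q : Fin n) (j : ℕ) (s : Fin n) (k : ℕ) where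
    open Embedding S

    c d e : Fin n
    c = nth p (order p) i
    d = nth q (order q) j
    e = nth s (order s) k

    ρ′ : RotationSystem n
    ρ′ = update₃ ρ p (splice (splice (ρ p) c s) c q) q (splice (ρ q) d p) s (splice (ρ s) e p)

    order′ : Fin n → List (Fin n)
    order′ = update₃ order p (insertAfter i (q ∷ s ∷ []) (order p))
                           q (insertAfter j (p ∷ []) (order q))
                           s (insertAfter k (p ∷ []) (order s))

    face′ : (Y Z T : List (Dart n)) → List (Dart n)
    face′ Y Z T = (c , p) ∷ (p , q) ∷ Z ++ (e , s) ∷ (s , p) ∷ Y ++ (d , q) ∷ (q , p) ∷ (p , s) ∷ T

    attached : (Y Z T : List (Dart n)) → Embedding
    attached Y Z T = embedding ρ′ order′ (face′ Y Z T)

  module AttachSites (S : Embedding) (p : Fin n) (i : ℕ) {q s : Fin n} (j k : ℕ)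
                     (q≢p : q ≢ p) (s≢p : s ≢ p) (s≢q : s ≢ q) where
    open Embedding S
    open Attach S p i q j s k

    ρ′-p : ρ′ p ≡ splice (splice (ρ p) c s) c q
    ρ′-p = update₃-a ρ p q s _ _ _
    ρ′-q : ρ′ q ≡ splice (ρ q) d p
    ρ′-q = update₃-b ρ p q s _ _ _ q≢p
    ρ′-s : ρ′ s ≡ splice (ρ s) e p
    ρ′-s = update₃-c ρ p q s _ _ _ s≢p s≢q
    ρ′-other : ∀ {v} → v ≢ p → v ≢ q → v ≢ s → ρ′ v ≡ ρ v
    ρ′-other = update₃-other ρ p q s _ _ _

    order′-p : order′ p ≡ insertAfter i (q ∷ s ∷ []) (order p)
    order′-p = update₃-a order p q s _ _ _
    order′-q : order′ q ≡ insertAfter j (p ∷ []) (order q)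
    order′-q = update₃-b order p q s _ _ _ q≢p
    order′-s : order′ s ≡ insertAfter k (p ∷ []) (order s)
    order′-s = update₃-c order p q s _ _ _ s≢p s≢q
    order′-other : ∀ {v} → v ≢ p → v ≢ q → v ≢ s → order′ v ≡ order v
    order′-other = update₃-other order p q s _ _ _

  module AttachProof {head E S} (I : OneFaceEmbedding head E S) {p q s : Fin n} {i j k : ℕ}
    (p≢q : p ≢ q) (p≢s : p ≢ s) (q≢s : q ≢ s)
    (qp∉E : (q , p) D.∉ E) (sp∉E : (s , p) D.∉ E) (pq∉E : (p , q) D.∉ E) (ps∉E : (p , s) D.∉ E)
    (i< : i < degree E p) (j< : j < degree E q) (k< : k < degree E s) where

    open Embedding S
    open OneFaceEmbedding I
    open OneFaceProperties I
    open Attach S p i q j s k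
    open ≡-Reasoning

    q≢p : q ≢ p
    q≢p = p≢q ∘ sym
    s≢p : s ≢ p
    s≢p = p≢s ∘ sym
    s≢q : s ≢ q
    s≢q = q≢s ∘ sym

    open AttachSites S p i j k q≢p s≢p s≢q

    c≢p : c ≢ p
    c≢p = ∈order⇒≢ p (nth∈ p (order p) i (<length i<)) (E-loopless p)
    c≢q : c ≢ q
    c≢q = ∈order⇒≢ q (nth∈ p (order p) i (<length i<)) qp∉E
    c≢s : c ≢ s
    c≢s = ∈order⇒≢ s (nth∈ p (order p) i (<length i<)) sp∉E
    d≢q : d ≢ q
    d≢q = ∈order⇒≢ q (nth∈ q (order q) j (<length j<)) (E-loopless q)
    d≢p : d ≢ p
    d≢p = ∈order⇒≢ p (nth∈ q (order q) j (<length j<)) pq∉E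
    e≢s : e ≢ s
    e≢s = ∈order⇒≢ s (nth∈ s (order s) k (<length k<)) (E-loopless s)
    e≢p : e ≢ p
    e≢p = ∈order⇒≢ p (nth∈ s (order s) k (<length k<)) ps∉E

    data Site (v : Fin n) : Set where
      is-p  : v ≡ p → Site v
      is-q  : v ≡ q → Site v
      is-s  : v ≡ s → Site v
      other : v ≢ p → v ≢ q → v ≢ s → Site v

    site : ∀ v → Site v
    site v with v ≟ p | v ≟ q | v ≟ s
    ... | yes v≡p | _       | _       = is-p v≡p
    ... | no  _   | yes v≡q | _       = is-q v≡q
    ... | no  _   | no  _   | yes v≡s = is-s v≡s
    ... | no v≢p  | no v≢q  | no v≢s  = other v≢p v≢q v≢s

    -- Splicing s and then q after c lists them as c, q, s.
    ρ′-cycle-p : Cycle (splice (splice (ρ p) c s) c q) (insertAfter i (q ∷ s ∷ []) (order p))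
    ρ′-cycle-p rewrite insertAfter-∷ i q (s ∷ []) (order p) (<length i<) =
      subst (λ x → Cycle (splice (splice (ρ p) c s) x q) (insertAfter i (q ∷ []) with-s))
        (nth-insertAfter p i (s ∷ []) (order p) (<length i<))
        (Cycle-splice p i q with-s
          (subst (i <_) (sym (length-insertAfter i (s ∷ []) (order p))) (<-≤-trans (<length i<) (m≤m+n _ 1)))
          (NoDuplicates-insertAfter i s (order p) (order-nodup p) (∉order s p sp∉E))
          (absent (trans (count-insertAfter q i (s ∷ []) (order p))
                         (cong₂ _+_ (count≡0 (∉order q p qp∉E)) (cong (_+ 0) (δ-≢ q≢s)))))
          (Cycle-splice p i s (order p) (<length i<) (order-nodup p) (∉order s p sp∉E) (ρ-cycle p)))
      where
      with-s = insertAfter i (s ∷ []) (order p)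

    ρ′-cycle : ∀ v → Cycle (ρ′ v) (order′ v)
    ρ′-cycle v with site v
    ... | is-p refl = subst₂ Cycle (sym ρ′-p) (sym order′-p) ρ′-cycle-p
    ... | is-q refl = subst₂ Cycle (sym ρ′-q) (sym order′-q)
                        (Cycle-splice q j p (order q) (<length j<) (order-nodup q) (∉order p q pq∉E) (ρ-cycle q))
    ... | is-s refl = subst₂ Cycle (sym ρ′-s) (sym order′-s)
                        (Cycle-splice s k p (order s) (<length k<) (order-nodup s) (∉order p s ps∉E) (ρ-cycle s))
    ... | other v≢p v≢q v≢s =
      subst₂ Cycle (sym (ρ′-other v≢p v≢q v≢s)) (sym (order′-other v≢p v≢q v≢s)) (ρ-cycle v)

    count-newDarts : ∀ u v → D.count (u , v) (newDarts p q s) ≡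
                     δ u p * δ v q + (δ u q * δ v p + (δ u p * δ v s + (δ u s * δ v p + 0)))
    count-newDarts u v rewrite δ-dart u v p q | δ-dart u v q p | δ-dart u v p s | δ-dart u v s p = refl

    newDarts-at-p : ∀ u → D.count (u , p) (newDarts p q s) ≡ count u (q ∷ s ∷ [])
    newDarts-at-p u rewrite count-newDarts u p | δ-refl p | δ-≢ p≢q | δ-≢ p≢s
                          | *-zeroʳ (δ u p) | *-identityʳ (δ u q) | *-identityʳ (δ u s) = refl

    newDarts-at-q : ∀ u → D.count (u , q) (newDarts p q s) ≡ count u (p ∷ [])
    newDarts-at-q u rewrite count-newDarts u q | δ-refl q | δ-≢ q≢p | δ-≢ q≢s
                          | *-zeroʳ (δ u q) | *-zeroʳ (δ u p) | *-zeroʳ (δ u s) | *-identityʳ (δ u p) = refl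

    newDarts-at-s : ∀ u → D.count (u , s) (newDarts p q s) ≡ count u (p ∷ [])
    newDarts-at-s u rewrite count-newDarts u s | δ-refl s | δ-≢ s≢p | δ-≢ s≢q
                          | *-zeroʳ (δ u s) | *-zeroʳ (δ u p) | *-zeroʳ (δ u q) | *-identityʳ (δ u p) = refl

    newDarts-elsewhere : ∀ u {v} → v ≢ p → v ≢ q → v ≢ s → D.count (u , v) (newDarts p q s) ≡ 0
    newDarts-elsewhere u {v} v≢p v≢q v≢s rewrite count-newDarts u v | δ-≢ v≢p | δ-≢ v≢q | δ-≢ v≢s
                                               | *-zeroʳ (δ u p) | *-zeroʳ (δ u q) | *-zeroʳ (δ u s) = refl

    count-grows : ∀ {u v t ys} → order′ v ≡ insertAfter t ys (order v) →
                  D.count (u , v) (newDarts p q s) ≡ count u ys →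
                  count u (order′ v) ≡ count u (order v) + D.count (u , v) (newDarts p q s)
    count-grows {u} {v} {t} {ys} eq new =
      trans (cong (count u) eq) (trans (count-insertAfter u t ys (order v)) (cong (count u (order v) +_) (sym new)))

    count-order′ : ∀ v u → count u (order′ v) ≡ count u (order v) + D.count (u , v) (newDarts p q s)
    count-order′ v u with site v
    ... | is-p refl = count-grows order′-p (newDarts-at-p u)
    ... | is-q refl = count-grows order′-q (newDarts-at-q u)
    ... | is-s refl = count-grows order′-s (newDarts-at-s u)
    ... | other v≢p v≢q v≢s =
      trans (cong (count u) (order′-other v≢p v≢q v≢s))
        (sym (trans (cong (count u (order v) +_) (newDarts-elsewhere u v≢p v≢q v≢s)) (+-identityʳ _)))

    length-grows : ∀ {v t ys} → order′ v ≡ insertAfter t ys (order v) →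
                   degree (newDarts p q s) v ≡ length ys →
                   length (order′ v) ≡ length (order v) + degree (newDarts p q s) v
    length-grows {v} {t} {ys} eq new =
      trans (cong length eq) (trans (length-insertAfter t ys (order v)) (cong (length (order v) +_) (sym new)))

    degree-newDarts-p : degree (newDarts p q s) p ≡ 2
    degree-newDarts-p rewrite δ-refl p | δ-≢ p≢q | δ-≢ p≢s = refl

    degree-newDarts-q : degree (newDarts p q s) q ≡ 1
    degree-newDarts-q rewrite δ-refl q | δ-≢ q≢p | δ-≢ q≢s = refl

    degree-newDarts-s : degree (newDarts p q s) s ≡ 1
    degree-newDarts-s rewrite δ-refl s | δ-≢ s≢p | δ-≢ s≢q = refl

    degree-newDarts-elsewhere : ∀ {v} → v ≢ p → v ≢ q → v ≢ s → degree (newDarts p q s) v ≡ 0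
    degree-newDarts-elsewhere v≢p v≢q v≢s rewrite δ-≢ v≢p | δ-≢ v≢q | δ-≢ v≢s = refl

    length-order′ : ∀ v → length (order′ v) ≡ length (order v) + degree (newDarts p q s) v
    length-order′ v with site v
    ... | is-p refl = length-grows order′-p degree-newDarts-p
    ... | is-q refl = length-grows order′-q degree-newDarts-q
    ... | is-s refl = length-grows order′-s degree-newDarts-s
    ... | other v≢p v≢q v≢s =
      trans (cong length (order′-other v≢p v≢q v≢s))
        (sym (trans (cong (length (order v) +_) (degree-newDarts-elsewhere v≢p v≢q v≢s)) (+-identityʳ _)))

    ρ′-fix : ∀ v → ρ′ v v ≡ v
    ρ′-fix v with site v
    ... | is-p refl = begin
      ρ′ v v                           ≡⟨ cong-app ρ′-p v ⟩
      splice (splice (ρ v) c s) c q v  ≡⟨ splice-other _ (c≢p ∘ sym) p≢q ⟩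
      splice (ρ v) c s v               ≡⟨ splice-other _ (c≢p ∘ sym) p≢s ⟩
      ρ v v                            ≡⟨ ρ-fix v ⟩
      v                                ∎
    ... | is-q refl = begin
      ρ′ v v                ≡⟨ cong-app ρ′-q v ⟩
      splice (ρ v) d p v    ≡⟨ splice-other _ (d≢q ∘ sym) q≢p ⟩
      ρ v v                 ≡⟨ ρ-fix v ⟩
      v                     ∎
    ... | is-s refl = begin
      ρ′ v v                ≡⟨ cong-app ρ′-s v ⟩
      splice (ρ v) e p v    ≡⟨ splice-other _ (e≢s ∘ sym) s≢p ⟩
      ρ v v                 ≡⟨ ρ-fix v ⟩
      v                     ∎
    ... | other v≢p v≢q v≢s = trans (cong-app (ρ′-other v≢p v≢q v≢s) v) (ρ-fix v)

    head-kept : ∀ {v xs} → order′ v ≡ xs → ∃[ t ] xs ≡ head v ∷ t → ∃[ t ] order′ v ≡ head v ∷ t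
    head-kept eq (t , eq′) = t , trans eq eq′

    order′-head : ∀ v → ∃[ t ] order′ v ≡ head v ∷ t
    order′-head v with site v | order-head v
    ... | is-p refl | t , eq =
      head-kept (trans order′-p (cong (insertAfter i _) eq)) (insertAfter-head i _ (head v) t)
    ... | is-q refl | t , eq =
      head-kept (trans order′-q (cong (insertAfter j _) eq)) (insertAfter-head j _ (head v) t)
    ... | is-s refl | t , eq =
      head-kept (trans order′-s (cong (insertAfter k _) eq)) (insertAfter-head k _ (head v) t)
    ... | other v≢p v≢q v≢s | t , eq = head-kept (order′-other v≢p v≢q v≢s) (t , eq)

    newDarts-nodup : D.NoDuplicates (newDarts p q s)
    newDarts-nodup =
      D.NoDuplicates-∷
        (D.∉-∷ (p≢q ∘ cong proj₁) (D.∉-∷ (q≢s ∘ cong proj₂) (D.∉-∷ (p≢s ∘ cong proj₁) (D.absent refl))))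
        (D.NoDuplicates-∷ (D.∉-∷ (q≢p ∘ cong proj₁) (D.∉-∷ (q≢s ∘ cong proj₁) (D.absent refl)))
          (D.NoDuplicates-∷ (D.∉-∷ (p≢s ∘ cong proj₁) (D.absent refl))
            (D.NoDuplicates-∷ (D.absent refl) (D.nodup λ _ → z≤n))))

    newDarts-fresh : D.Disjoint (newDarts p q s) E
    newDarts-fresh z∈ with D.∈-∷⁻ z∈
    ... | inj₁ refl = pq∉E
    ... | inj₂ z∈₁ with D.∈-∷⁻ z∈₁
    ...   | inj₁ refl = qp∉E
    ...   | inj₂ z∈₂ with D.∈-∷⁻ z∈₂
    ...     | inj₁ refl = ps∉E
    ...     | inj₂ z∈₃ with D.∈-∷⁻ z∈₃
    ...       | inj₁ refl = sp∉E
    ...       | inj₂ (D.occurs ())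

    E′-simple : D.NoDuplicates (newDarts p q s ++ E)
    E′-simple = D.NoDuplicates-++ newDarts-nodup E-simple newDarts-fresh

    E′-loopless : ∀ v → (v , v) D.∉ newDarts p q s ++ E
    E′-loopless v =
      D.absent (trans (D.count-++ (v , v) (newDarts p q s) E)
                      (cong₂ _+_ (D.count≡0 not-new) (D.count≡0 (E-loopless v))))
      where
      loop≢ : ∀ {a b} → a ≢ b → (v , v) ≢ (a , b)
      loop≢ a≢b eq = a≢b (trans (sym (cong proj₁ eq)) (cong proj₂ eq))
      not-new : (v , v) D.∉ newDarts p q s
      not-new =
        D.∉-∷ (loop≢ p≢q) (D.∉-∷ (loop≢ q≢p) (D.∉-∷ (loop≢ p≢s) (D.∉-∷ (loop≢ s≢p) (D.absent refl))))

    order′-count : ∀ v u → count u (order′ v) ≡ D.count (u , v) (newDarts p q s ++ E)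
    order′-count v u = begin
      count u (order′ v)                                     ≡⟨ count-order′ v u ⟩
      count u (order v) + D.count (u , v) (newDarts p q s)   ≡⟨ cong (_+ _) (order-count v u) ⟩
      D.count (u , v) E + D.count (u , v) (newDarts p q s)   ≡⟨ +-comm (D.count (u , v) E) _ ⟩
      D.count (u , v) (newDarts p q s) + D.count (u , v) E   ≡⟨ D.count-++ (u , v) (newDarts p q s) E ⟨
      D.count (u , v) (newDarts p q s ++ E)                  ∎

    order′-length : ∀ v → length (order′ v) ≡ degree (newDarts p q s ++ E) v
    order′-length v = begin
      length (order′ v)                                 ≡⟨ length-order′ v ⟩
      length (order v) + degree (newDarts p q s) v      ≡⟨ cong (_+ _) (order-length v) ⟩
      degree E v + degree (newDarts p q s) v            ≡⟨ +-comm (degree E v) _ ⟩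
      degree (newDarts p q s) v + degree E v            ≡⟨ degree-++ (newDarts p q s) E v ⟨
      degree (newDarts p q s ++ E) v                    ∎

    φ φ′ : Dart n → Dart n
    φ  = faceStep ρ
    φ′ = faceStep ρ′

    Dc Dq Ds : Dart n
    Dc = (c , p)
    Dq = (d , q)
    Ds = (e , s)

    ρ′-old : ∀ {u v} → u ∈ order v → (u , v) ≢ Dc → (u , v) ≢ Dq → (u , v) ≢ Ds → ρ′ v u ≡ ρ v u
    ρ′-old {u} {v} u∈ ≢c ≢q ≢s with site v
    ... | is-p refl = begin
      ρ′ v u                           ≡⟨ cong-app ρ′-p u ⟩
      splice (splice (ρ v) c s) c q u  ≡⟨ splice-other _ (≢c ∘ cong (_, v)) (∈order⇒≢ q u∈ qp∉E) ⟩
      splice (ρ v) c s u               ≡⟨ splice-other _ (≢c ∘ cong (_, v)) (∈order⇒≢ s u∈ sp∉E) ⟩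
      ρ v u                            ∎
    ... | is-q refl = trans (cong-app ρ′-q u) (splice-other _ (≢q ∘ cong (_, v)) (∈order⇒≢ p u∈ pq∉E))
    ... | is-s refl = trans (cong-app ρ′-s u) (splice-other _ (≢s ∘ cong (_, v)) (∈order⇒≢ p u∈ ps∉E))
    ... | other v≢p v≢q v≢s = cong-app (ρ′-other v≢p v≢q v≢s) u

    Dc∈face : Dc D.∈ face
    Dc∈face = corner∈face i<

    rest : List (Dart n)
    rest = D.rotateAfter Dc face

    φ′-Dc : φ′ Dc ≡ (p , q)
    φ′-Dc = cong (p ,_) (trans (cong-app ρ′-p c) (splice-at _ c q))

    φ′-pq : φ′ (p , q) ≡ φ Dq
    φ′-pq = cong (q ,_) (trans (cong-app ρ′-q p) (splice-new (ρ q) (d≢p ∘ sym)))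

    φ′-Dq : φ′ Dq ≡ (q , p)
    φ′-Dq = cong (q ,_) (trans (cong-app ρ′-q d) (splice-at _ d p))

    φ′-qp : φ′ (q , p) ≡ (p , s)
    φ′-qp = cong (p ,_) (begin
      ρ′ p q                           ≡⟨ cong-app ρ′-p q ⟩
      splice (splice (ρ p) c s) c q q  ≡⟨ splice-new _ (c≢q ∘ sym) ⟩
      splice (ρ p) c s c               ≡⟨ splice-at _ c s ⟩
      s                                ∎)

    φ′-ps : φ′ (p , s) ≡ φ Ds
    φ′-ps = cong (s ,_) (trans (cong-app ρ′-s p) (splice-new (ρ s) (e≢p ∘ sym)))

    φ′-Ds : φ′ Ds ≡ (s , p)
    φ′-Ds = cong (s ,_) (trans (cong-app ρ′-s e) (splice-at _ e p))

    φ′-sp : φ′ (s , p) ≡ φ Dc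
    φ′-sp = cong (p ,_) (begin
      ρ′ p s                           ≡⟨ cong-app ρ′-p s ⟩
      splice (splice (ρ p) c s) c q s  ≡⟨ splice-other _ (c≢s ∘ sym) s≢q ⟩
      splice (ρ p) c s s               ≡⟨ splice-new (ρ p) (c≢s ∘ sym) ⟩
      ρ p c                            ∎)

    module NewFace (Y Z T : List (Dart n)) (split : rest ≡ Y ++ Dq ∷ Z ++ Ds ∷ T) where

      old : List (Dart n)
      old = Y ++ Z ++ T

      count-face : ∀ z → D.count z face ≡ (D.δ z Dc + (D.δ z Dq + D.δ z Ds)) + D.count z old
      count-face z rewrite D.count-rotateAfter Dc∈face z | split
                         | D.count-++ z Y (Dq ∷ Z ++ Ds ∷ T) | D.count-++ z Z (Ds ∷ T)
                         | D.count-++ z Y (Z ++ T) | D.count-++ z Z T =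
        shuffle (D.δ z Dc) (D.count z Y) (D.δ z Dq) (D.count z Z) (D.δ z Ds) (D.count z T)
        where
        shuffle : ∀ a y b z c t → a + (y + (b + (z + (c + t)))) ≡ (a + (b + c)) + (y + (z + t))
        shuffle = solve-∀

      -- Every old dart occurs once in the face, so it is none of the three corner darts.
      old-dart : ∀ {z} → z D.∈ old → z D.∈ face × z ≢ Dc × z ≢ Dq × z ≢ Ds
      old-dart {z} (D.occurs pos) =
        D.occurs (subst (0 <_) (sym (count-face z)) (≤-trans pos (m≤n+m _ _))) ,
        D.δ≡0⇒≢ (m+n≡0⇒m≡0 (D.δ z Dc) corners≡0) ,
        D.δ≡0⇒≢ (m+n≡0⇒m≡0 (D.δ z Dq) (m+n≡0⇒n≡0 (D.δ z Dc) corners≡0)) ,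
        D.δ≡0⇒≢ (m+n≡0⇒n≡0 (D.δ z Dq) (m+n≡0⇒n≡0 (D.δ z Dc) corners≡0))
        where
        corners≡0 : D.δ z Dc + (D.δ z Dq + D.δ z Ds) ≡ 0
        corners≡0 =
          m+n≤1∧n>0⇒m≡0 _ (subst (_≤ 1) (trans (sym (face-count z)) (count-face z)) (D.count≤1 E-simple z)) pos

      φ′-old : ∀ {z} → z D.∈ old → φ′ z ≡ φ z
      φ′-old {u , v} z∈ =
        let (z∈face , ≢c , ≢q , ≢s) = old-dart z∈
        in cong (v ,_) (ρ′-old (∈face⇒∈order z∈face) ≢c ≢q ≢s)

      walk : Path φ Dc (Y ++ Dq ∷ Z ++ Ds ∷ T) Dc
      walk = subst (λ M → Path φ Dc M Dc) split (D.Cycle-rotateAfter Dc∈face face-cycle)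

      walk-Y : Path φ Dc Y Dq
      walk-Y = proj₁ (Path-++⁻ Y walk)

      walk-Z : Path φ Dq Z Ds
      walk-Z = proj₁ (Path-++⁻ Z (proj₂ (Path-++⁻ Y walk)))

      walk-T : Path φ Ds T Dc
      walk-T = proj₂ (Path-++⁻ Z (proj₂ (Path-++⁻ Y walk)))

      face′-cycle : Cycle φ′ (face′ Y Z T)
      face′-cycle =
        φ′-Dc , Path-++⁺ Z (D.Path-cong Z (λ _ → φ′-old ∘ D.∈-++⁺ʳ Y ∘ D.∈-++⁺ˡ Z) φ′-pq walk-Z)
                  (φ′-Ds , Path-++⁺ Y (D.Path-cong Y (λ _ → φ′-old ∘ D.∈-++⁺ˡ Y) φ′-sp walk-Y)
                             (φ′-Dq , φ′-qp ,
                              D.Path-cong T (λ _ → φ′-old ∘ D.∈-++⁺ʳ Y ∘ D.∈-++⁺ʳ Z) φ′-ps walk-T))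

      count-face′ : ∀ z → D.count z (face′ Y Z T) ≡ D.count z (newDarts p q s ++ E)
      count-face′ z rewrite D.count-++ z (newDarts p q s) E | sym (face-count z) | count-face z
                          | D.count-++ z Z (Ds ∷ (s , p) ∷ Y ++ Dq ∷ (q , p) ∷ (p , s) ∷ T)
                          | D.count-++ z Y (Dq ∷ (q , p) ∷ (p , s) ∷ T)
                          | D.count-++ z Y (Z ++ T) | D.count-++ z Z T =
        shuffle (D.δ z Dc) (D.δ z (p , q)) (D.count z Z) (D.δ z Ds) (D.δ z (s , p))
                (D.count z Y) (D.δ z Dq) (D.δ z (q , p)) (D.δ z (p , s)) (D.count z T)
        where
        shuffle : ∀ a n₁ z c n₂ y b n₃ n₄ t →
          a + (n₁ + (z + (c + (n₂ + (y + (b + (n₃ + (n₄ + t)))))))) ≡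
          (n₁ + (n₃ + (n₄ + (n₂ + 0)))) + ((a + (b + c)) + (y + (z + t)))
        shuffle = solve-∀

      length-face′ : length (face′ Y Z T) ≡ length (newDarts p q s ++ E)
      length-face′ rewrite sym face-length | D.length-rotateAfter Dc∈face | split
                         | length-++ Z {Ds ∷ (s , p) ∷ Y ++ Dq ∷ (q , p) ∷ (p , s) ∷ T}
                         | length-++ Y {Dq ∷ (q , p) ∷ (p , s) ∷ T}
                         | length-++ Y {Dq ∷ Z ++ Ds ∷ T} | length-++ Z {Ds ∷ T} =
        shuffle (length Y) (length Z) (length T)
        where
        shuffle : ∀ y z t → 2 + (z + (2 + (y + (3 + t)))) ≡ 4 + suc (y + suc (z + suc t))
        shuffle = solve-∀

      oneFace : OneFaceEmbedding head (newDarts p q s ++ E) (attached Y Z T)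
      oneFace = record
        { ρ-cycle = ρ′-cycle ; ρ-fix = ρ′-fix ; order-head = order′-head
        ; order-count = order′-count ; order-length = order′-length
        ; face-cycle = face′-cycle ; face-count = count-face′ ; face-length = length-face′
        ; E-simple = E′-simple ; E-loopless = E′-loopless }

  Addable : List (Dart n) → Fin n → Fin n → Fin n → Set
  Addable E p q s =
    p ≢ q × p ≢ s × q ≢ s × (q , p) D.∉ E × (s , p) D.∉ E × (p , q) D.∉ E × (p , s) D.∉ E

  attach-OneFace : ∀ {head E S p q s i j k} → OneFaceEmbedding head E S → Addable E p q s →
    i < degree E p → j < degree E q → k < degree E s → ∀ Y Z T →
    D.rotateAfter (nth p (Embedding.order S p) i , p) (Embedding.face S) ≡
      Y ++ (nth q (Embedding.order S q) j , q) ∷ Z ++ (nth s (Embedding.order S s) k , s) ∷ T →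
    OneFaceEmbedding head (newDarts p q s ++ E) (Attach.attached S p i q j s k Y Z T)
  attach-OneFace I (p≢q , p≢s , q≢s , qp∉E , sp∉E , pq∉E , ps∉E) i< j< k< Y Z T split =
    AttachProof.NewFace.oneFace I p≢q p≢s q≢s qp∉E sp∉E pq∉E ps∉E i< j< k< Y Z T split

  OneFace-respects : ∀ {head E E′ S} → (∀ z → D.count z E ≡ D.count z E′) →
                     (∀ v → degree E v ≡ degree E′ v) → length E ≡ length E′ →
                     OneFaceEmbedding head E S → OneFaceEmbedding head E′ S
  OneFace-respects counts degrees len I = record
    { ρ-cycle      = ρ-cycle
    ; ρ-fix        = ρ-fix
    ; order-head   = order-head
    ; order-count  = λ v u → trans (order-count v u) (counts (u , v))
    ; order-length = λ v → trans (order-length v) (degrees v)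
    ; face-cycle   = face-cycle
    ; face-count   = λ z → trans (face-count z) (counts z)
    ; face-length  = trans face-length len
    ; E-simple     = D.nodup λ z → subst (_≤ 1) (counts z) (D.count≤1 E-simple z)
    ; E-loopless   = λ v → D.absent (trans (sym (counts (v , v))) (D.count≡0 (E-loopless v)))
    }
    where open OneFaceEmbedding I

  swap₂ : ∀ a b c d e → a + (b + (c + (d + e))) ≡ c + (d + (a + (b + e)))
  swap₂ = solve-∀

  OneFace-swap : ∀ {head E S p q s} → OneFaceEmbedding head (newDarts p s q ++ E) S →
                 OneFaceEmbedding head (newDarts p q s ++ E) S
  OneFace-swap {E = E} {p = p} {q} {s} =
    OneFace-respects
      (λ z → swap₂ (D.δ z (p , s)) (D.δ z (s , p)) (D.δ z (p , q)) (D.δ z (q , p)) (D.count z E))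
                     (λ v → swap₂ (δ v s) (δ v p) (δ v q) (δ v p) (degree E v)) refl

  module Step (S : Embedding) (p q s : Fin n) (i j k : ℕ) where
    open Embedding S

    Dc Dq Ds : Dart n
    Dc = (nth p (order p) i , p)
    Dq = (nth q (order q) j , q)
    Ds = (nth s (order s) k , s)

    rest : List (Dart n)
    rest = D.rotateAfter Dc face

    Arm : Dart n → Set
    Arm z = z ≡ Dq ⊎ z ≡ Ds

    arm? : Decidable Arm
    arm? z = z ≟ᵈ Dq ⊎-dec z ≟ᵈ Ds

    -- Read from the corner at p, the face meets the corners at q and s in some order; the new edges
    -- leave p in that order.  The last clause is unreachable for a one-face embedding.
    arrange : List (Dart n) × List (Dart n) → Embedding
    arrange (Y , m ∷ M) with m ≟ᵈ Dq
    ... | yes _ = Attach.attached S p i q j s k Y (proj₁ (D.around Ds M)) (proj₂ (D.around Ds M))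
    ... | no  _ = Attach.attached S p i s k q j Y (proj₁ (D.around Dq M)) (proj₂ (D.around Dq M))
    arrange (Y , []) = Attach.attached S p i q j s k Y [] []

    result : Embedding
    result = arrange (D.splitWhen arm? rest)

  step : Fin n → Fin n → Fin n → ℕ → ℕ → ℕ → Embedding → Embedding
  step p q s i j k S = Step.result S p q s i j k

  step-OneFace : ∀ {head E S p q s i j k} → OneFaceEmbedding head E S → Addable E p q s →
    i < degree E p → j < degree E q → k < degree E s →
    OneFaceEmbedding head (newDarts p q s ++ E) (step p q s i j k S)
  step-OneFace {head} {E} {S} {p} {q} {s} {i} {j} {k}
               I add@(p≢q , p≢s , q≢s , qp∉E , sp∉E , pq∉E , ps∉E) i< j< k< =
    let (m , R , e₂ , split , arm-m , clear) = D.splitWhen-spec arm? rest Dq∈rest (inj₁ refl)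
    in subst (OneFaceEmbedding head (newDarts p q s ++ E)) (sym (cong (λ t → arrange (Y , t)) e₂))
             (arranged m R split clear arm-m)
    where
    open Embedding S
    open Step S p q s i j k
    open OneFaceProperties I
    Y = proj₁ (D.splitWhen arm? rest)

    Dc∈face : Dc D.∈ face
    Dc∈face = corner∈face i<

    arm∈rest : ∀ {v t} → t < degree E v → v ≢ p → (nth v (order v) t , v) D.∈ rest
    arm∈rest t< v≢p = D.∈-rotateAfter⁺ Dc∈face (corner∈face t<) (v≢p ∘ cong proj₂)

    Dq∈rest : Dq D.∈ rest
    Dq∈rest = arm∈rest j< (p≢q ∘ sym)

    later-arm : ∀ {m R w} → rest ≡ Y ++ m ∷ R → All (¬_ ∘ Arm) Y →
                w D.∈ rest → Arm w → w ≢ m → w D.∈ R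
    later-arm split clear w∈ arm-w w≢m with D.∈-++⁻ Y (subst (_ D.∈_) split w∈)
    ... | inj₁ w∈Y = contradiction arm-w (D.∈-All clear w∈Y)
    ... | inj₂ w∈mR with D.∈-∷⁻ w∈mR
    ...   | inj₁ w≡m = contradiction w≡m w≢m
    ...   | inj₂ w∈R = w∈R

    arranged : ∀ m R → rest ≡ Y ++ m ∷ R → All (¬_ ∘ Arm) Y → Arm m →
               OneFaceEmbedding head (newDarts p q s ++ E) (arrange (Y , m ∷ R))
    arranged m R split clear arm-m with m ≟ᵈ Dq
    ... | yes refl =
      attach-OneFace I add i< j< k< Y _ _
        (trans split (cong (λ X → Y ++ Dq ∷ X) (D.around-spec R Ds∈R)))
      where
      Ds∈R : Ds D.∈ R
      Ds∈R = later-arm split clear (arm∈rest k< (p≢s ∘ sym)) (inj₂ refl) (q≢s ∘ sym ∘ cong proj₂)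
    ... | no m≢Dq with arm-m
    ...   | inj₁ m≡Dq = contradiction m≡Dq m≢Dq
    ...   | inj₂ refl =
      OneFace-swap
        (attach-OneFace I (p≢s , p≢q , q≢s ∘ sym , sp∉E , qp∉E , ps∉E , pq∉E) i< k< j< Y _ _
          (trans split (cong (λ X → Y ++ Ds ∷ X) (D.around-spec R Dq∈R))))
      where
      Dq∈R : Dq D.∈ R
      Dq∈R = later-arm split clear Dq∈rest (inj₁ refl) (q≢s ∘ cong proj₂)

  module _ (S : Embedding) (p q s : Fin n) (i j k : ℕ) where
    open Embedding

    step-attaches : order (step p q s i j k S) ≡ Attach.order′ S p i q j s k ⊎
                    order (step p q s i j k S) ≡ Attach.order′ S p i s k q j
    step-attaches = arrange-attaches (D.splitWhen arm? rest)
      where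
      open Step S p q s i j k
      arrange-attaches : ∀ x → order (arrange x) ≡ Attach.order′ S p i q j s k ⊎
                               order (arrange x) ≡ Attach.order′ S p i s k q j
      arrange-attaches (Y , m ∷ M) with m ≟ᵈ Dq
      ... | yes _ = inj₁ refl
      ... | no  _ = inj₂ refl
      arrange-attaches (Y , []) = inj₁ refl

    module _ (p≢q : p ≢ q) (p≢s : p ≢ s) (q≢s : q ≢ s) where
      private
        module QS = AttachSites S p i j k (p≢q ∘ sym) (p≢s ∘ sym) (q≢s ∘ sym)
        module SQ = AttachSites S p i k j (p≢s ∘ sym) (p≢q ∘ sym) q≢s

      step-order-p : ∃[ a ] ∃[ b ] (a ∈ q ∷ s ∷ [] ×
                                    order (step p q s i j k S) p ≡ insertAfter i (a ∷ b ∷ []) (order S p))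
      step-order-p with step-attaches
      ... | inj₁ eq = q , s , ∈-head q _ , trans (cong-app eq p) QS.order′-p
      ... | inj₂ eq = s , q , ∈-tail q (∈-head s []) , trans (cong-app eq p) SQ.order′-p

      step-order-q : order (step p q s i j k S) q ≡ insertAfter j (p ∷ []) (order S q)
      step-order-q with step-attaches
      ... | inj₁ eq = trans (cong-app eq q) QS.order′-q
      ... | inj₂ eq = trans (cong-app eq q) SQ.order′-s

      step-order-s : order (step p q s i j k S) s ≡ insertAfter k (p ∷ []) (order S s)
      step-order-s with step-attaches
      ... | inj₁ eq = trans (cong-app eq s) QS.order′-s
      ... | inj₂ eq = trans (cong-app eq s) SQ.order′-q

      step-order-other : ∀ {v} → v ≢ p → v ≢ q → v ≢ s → order (step p q s i j k S) v ≡ order S v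
      step-order-other v≢p v≢q v≢s with step-attaches
      ... | inj₁ eq = trans (cong-app eq _) (QS.order′-other v≢p v≢q v≢s)
      ... | inj₂ eq = trans (cong-app eq _) (SQ.order′-other v≢p v≢s v≢q)

  step-injective : ∀ {head E S S′ p q s i j k i′ j′ k′} →
    OneFaceEmbedding head E S → OneFaceEmbedding head E S′ →
    Addable E p q s → i < degree E p → j < degree E q → k < degree E s →
    i′ < degree E p → j′ < degree E q → k′ < degree E s →
    (∀ v → Embedding.order (step p q s i j k S) v ≡ Embedding.order (step p q s i′ j′ k′ S′) v) →
    (∀ v → Embedding.order S v ≡ Embedding.order S′ v) × i ≡ i′ × j ≡ j′ × k ≡ k′
  step-injective {head} {E} {S} {S′} {p} {q} {s} {i} {j} {k} {i′} {j′} {k′} I I′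
                 (p≢q , p≢s , q≢s , qp∉E , sp∉E , pq∉E , ps∉E) i< j< k< i′< j′< k′< same =
    same-order , proj₁ recover-p , proj₁ recover-q , proj₁ recover-s
    where
    open Embedding
    module P = OneFaceProperties I
    module P′ = OneFaceProperties I′

    arms∉ : ∀ {T} → OneFaceEmbedding head E T → Disjoint (q ∷ s ∷ []) (order T p)
    arms∉ J z∈ with ∈-∷⁻ z∈
    ... | inj₁ refl = OneFaceProperties.∉order J q p qp∉E
    ... | inj₂ z∈s with ∈-∷⁻ z∈s
    ...   | inj₁ refl = OneFaceProperties.∉order J s p sp∉E
    ...   | inj₂ (occurs ())

    p∉ : ∀ {T v} → OneFaceEmbedding head E T → (p , v) D.∉ E → Disjoint (p ∷ []) (order T v)
    p∉ {v = v} J pv∉ z∈ with ∈-∷⁻ z∈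
    ... | inj₁ refl = OneFaceProperties.∉order J p v pv∉
    ... | inj₂ (occurs ())

    recover-p : i ≡ i′ × order S p ≡ order S′ p
    recover-p with step-order-p S p q s i j k p≢q p≢s q≢s | step-order-p S′ p q s i′ j′ k′ p≢q p≢s q≢s
    ... | _ , _ , a∈ , eq | _ , _ , a′∈ , eq′ =
      insertAfter-injective (q ∷ s ∷ []) (P.<length i<) (P′.<length i′<) (arms∉ I) (arms∉ I′) a∈ a′∈ refl
        (trans (sym eq) (trans (same p) eq′))

    recover-arm : ∀ {v t t′} → (p , v) D.∉ E → t < degree E v → t′ < degree E v →
                  order (step p q s i j k S) v ≡ insertAfter t (p ∷ []) (order S v) →
                  order (step p q s i′ j′ k′ S′) v ≡ insertAfter t′ (p ∷ []) (order S′ v) →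
                  t ≡ t′ × order S v ≡ order S′ v
    recover-arm {v} pv∉E t< t′< eq eq′ =
      insertAfter-injective (p ∷ []) (P.<length t<) (P′.<length t′<) (p∉ I pv∉E) (p∉ I′ pv∉E)
        (∈-head p []) (∈-head p []) refl (trans (sym eq) (trans (same v) eq′))

    recover-q : j ≡ j′ × order S q ≡ order S′ q
    recover-q = recover-arm pq∉E j< j′< (step-order-q S p q s i j k p≢q p≢s q≢s)
                                        (step-order-q S′ p q s i′ j′ k′ p≢q p≢s q≢s)

    recover-s : k ≡ k′ × order S s ≡ order S′ s
    recover-s = recover-arm ps∉E k< k′< (step-order-s S p q s i j k p≢q p≢s q≢s)
                                        (step-order-s S′ p q s i′ j′ k′ p≢q p≢s q≢s)

    same-order : ∀ v → order S v ≡ order S′ v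
    same-order v with v ≟ p | v ≟ q | v ≟ s
    ... | yes refl | _        | _        = proj₂ recover-p
    ... | no _     | yes refl | _        = proj₂ recover-q
    ... | no _     | no _     | yes refl = proj₂ recover-s
    ... | no v≢p   | no v≢q   | no v≢s   =
      trans (sym (step-order-other S p q s i j k p≢q p≢s q≢s v≢p v≢q v≢s))
        (trans (same v) (step-order-other S′ p q s i′ j′ k′ p≢q p≢s q≢s v≢p v≢q v≢s))

  Move : Set
  Move = Fin n × Fin n × Fin n

  grow : List (Dart n) → List Move → List (Dart n)
  grow E []                = E
  grow E ((p , q , s) ∷ ms) = grow (newDarts p q s ++ E) ms

  Schedulable : List (Dart n) → List Move → Set
  Schedulable E []                = ⊤
  Schedulable E ((p , q , s) ∷ ms) = Addable E p q s × Schedulable (newDarts p q s ++ E) ms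

  radices : List (Dart n) → List Move → List ℕ
  radices E []                = []
  radices E ((p , q , s) ∷ ms) = degree E p ∷ degree E q ∷ degree E s ∷ radices (newDarts p q s ++ E) ms

  -- Kept opaque: on symbolic corner indices, unfolding a whole run blows up type checking.
  opaque
    -- Missing corner indices make run stop early.
    run : List Move → List ℕ → Embedding → Embedding
    run ((p , q , s) ∷ ms) (i ∷ j ∷ k ∷ cs) S = run ms cs (step p q s i j k S)
    run _                  _                S = S

    run-OneFace : ∀ {head E S} ms {cs} → OneFaceEmbedding head E S → Schedulable E ms →
                  Pointwise _<_ cs (radices E ms) → OneFaceEmbedding head (grow E ms) (run ms cs S)
    run-OneFace []                I _              []                          = I
    run-OneFace ((p , q , s) ∷ ms) I (add , sched) (i< ∷ j< ∷ k< ∷ cs<) =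
      run-OneFace ms (step-OneFace I add i< j< k<) sched cs<

    run-injective : ∀ {head E S S′} ms {cs cs′} →
      OneFaceEmbedding head E S → OneFaceEmbedding head E S′ →
      Schedulable E ms → Pointwise _<_ cs (radices E ms) → Pointwise _<_ cs′ (radices E ms) →
      (∀ v → Embedding.order (run ms cs S) v ≡ Embedding.order (run ms cs′ S′) v) →
      (∀ v → Embedding.order S v ≡ Embedding.order S′ v) × cs ≡ cs′
    run-injective [] I I′ _ [] [] same = same , refl
    run-injective ((p , q , s) ∷ ms) I I′ (add , sched) (i< ∷ j< ∷ k< ∷ cs<) (i′< ∷ j′< ∷ k′< ∷ cs′<) same =
      let (same-step , cs≡) = run-injective ms (step-OneFace I add i< j< k<)
                                (step-OneFace I′ add i′< j′< k′<) sched cs< cs′< same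
          (same-order , i≡ , j≡ , k≡) = step-injective I I′ add i< j< k< i′< j′< k′< same-step
      in same-order , cong₂ _∷_ i≡ (cong₂ _∷_ j≡ (cong₂ _∷_ k≡ cs≡))

  module Complete {head E S} (I : OneFaceEmbedding head E S)
    (complete : ∀ u v → u ≢ v → (u , v) D.∈ E) (regular : ∀ v → degree E v ≡ n ∸ 1) where
    open Embedding S
    open OneFaceEmbedding I
    open OneFaceProperties I

    ∈order : ∀ {u v} → u ≢ v → u ∈ order v
    ∈order {u} {v} u≢v = occurs (subst (0 <_) (sym (order-count v u)) (D.count-pos (complete u v u≢v)))

    ∈face : ∀ {z} → proj₁ z ≢ proj₂ z → z D.∈ face
    ∈face {u , v} u≢v = ∈order⇒∈face (∈order u≢v)

    isRotationSystem : IsRotationSystem n ρ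
    isRotationSystem v = ρ-fix v , stays , reaches
      where
      stays : ∀ u → u ≢ v → ρ v u ≢ v
      stays u u≢v =
        ∈∧∉⇒≢ (Cycle-closed (order v) (ρ-cycle v) (∈order u≢v)) (∉order v v (E-loopless v))
      reaches : ∀ u w → u ≢ v → w ≢ v → ∃[ k ] (k < n ∸ 1 × iter (ρ v) k u ≡ w)
      reaches u w u≢v w≢v =
        let (k , k< , reach) = Cycle-reach (order v) (ρ-cycle v) (∈order u≢v) (∈order w≢v)
        in k , subst (k <_) (trans (order-length v) (regular v)) k< , reach

    -- Every dart lies on the one face, which therefore also contains d₀.
    notFaceRep : ∀ d d₀ → proj₁ d ≢ proj₂ d → proj₁ d₀ ≢ proj₂ d₀ → dartKey d₀ < dartKey d →
                 length E ≤ n * n → isFaceRep ρ d ≡ false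
    notFaceRep d d₀ d-edge d₀-edge key< len≤ =
      let (k , k< , reach) = D.Cycle-reach face face-cycle (∈face d-edge) (∈face d₀-edge)
      in allᵇ-applyUpTo≡false _ id (≤-trans k< (subst (_≤ n * n) (sym face-length) len≤))
           (trans (cong (λ z → dartKey d ≤ᵇ dartKey z) reach) (>⇒≤ᵇ≡false key<))

  addable? : ∀ E p q s → Dec (Addable E p q s)
  addable? E p q s = ¬? (p ≟ q) ×-dec ¬? (p ≟ s) ×-dec ¬? (q ≟ s) ×-dec
                     D.∉? (q , p) E ×-dec D.∉? (s , p) E ×-dec D.∉? (p , q) E ×-dec D.∉? (p , s) E

  schedulable? : ∀ E ms → Dec (Schedulable E ms)
  schedulable? E []                = yes tt
  schedulable? E ((p , q , s) ∷ ms) = addable? E p q s ×-dec schedulable? (newDarts p q s ++ E) ms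

-- Mixed-radix digits

digits : List ℕ → ℕ → List ℕ
digits []           m = []
digits (zero  ∷ rs) m = 0 ∷ digits rs m
digits (suc r ∷ rs) m = m % suc r ∷ digits rs (m / suc r)

digits-bounded : ∀ rs {m} → m < product rs → Pointwise _<_ (digits rs m) rs
digits-bounded []           _ = []
digits-bounded (suc r ∷ rs) {m} m< =
  m%n<n m (suc r) ∷ digits-bounded rs (m<n*o⇒m/o<n (subst (m <_) (*-comm (suc r) (product rs)) m<))

digits-injective : ∀ rs {m m′} → m < product rs → m′ < product rs →
                   digits rs m ≡ digits rs m′ → m ≡ m′
digits-injective []           {zero}  {zero}  _  _   _  = refl
digits-injective []           {suc _} (s≤s ())
digits-injective []           {zero}  {suc _} _  (s≤s ())
digits-injective (suc r ∷ rs) {m}     {m′}    m< m′< eq =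
  let (mod≡ , rest≡) = ∷-injective eq
      div≡ = digits-injective rs (m<n*o⇒m/o<n (subst (m <_) (*-comm (suc r) (product rs)) m<))
                                 (m<n*o⇒m/o<n (subst (m′ <_) (*-comm (suc r) (product rs)) m′<)) rest≡
  in begin
    m                              ≡⟨ m≡m%n+[m/n]*n m (suc r) ⟩
    m % suc r + m / suc r * suc r  ≡⟨ cong₂ (λ x y → x + y * suc r) mod≡ div≡ ⟩
    m′ % suc r + m′ / suc r * suc r ≡⟨ m≡m%n+[m/n]*n m′ (suc r) ⟨
    m′                             ∎
  where open ≡-Reasoning

-- The complete graph on ten vertices

open OneFaceEmbeddings 10
open Embedding

pathNeighbours : Fin 10 → List (Fin 10)
pathNeighbours v = filterᵇ (λ u → (suc (toℕ u) ≡ᵇ toℕ v) ∨ (suc (toℕ v) ≡ᵇ toℕ u)) (allFin 10)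

pathHead : Fin 10 → Fin 10
pathHead v = nth v (pathNeighbours v) 0

pathForward : List (Dart 10)
pathForward = map (λ k → inject₁ k , Fin.suc k) (allFin 9)

-- The path 0 - 1 - ... - 9 has a single face, walking the path forth and back.
path : Embedding
path = embedding (cyclicSucc ∘ pathNeighbours) pathNeighbours (pathForward ++ reverse (map swap pathForward))

path-OneFace : OneFaceEmbedding pathHead (face path) path
path-OneFace = record
  { ρ-cycle      = from-yes (FinP.all? λ v → cycle? (ρ path v) (pathNeighbours v))
  ; ρ-fix        = from-yes (FinP.all? λ v → ρ path v v ≟ v)
  ; order-head   = λ v → drop 1 (pathNeighbours v) ,
                         from-yes (FinP.all? λ v → ≡-dec _≟_ (pathNeighbours v)
                                                            (pathHead v ∷ drop 1 (pathNeighbours v))) v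
  ; order-count  = from-yes (FinP.all? λ v → FinP.all? λ u →
                               count u (pathNeighbours v) ℕ.≟ D.count (u , v) (face path))
  ; order-length = from-yes (FinP.all? λ v → length (pathNeighbours v) ℕ.≟ degree (face path) v)
  ; face-cycle   = from-yes (D.cycle? (faceStep (ρ path)) (face path))
  ; face-count   = λ _ → refl
  ; face-length  = refl
  ; E-simple     = D.nodup λ (u , v) →
                     from-yes (FinP.all? λ u → FinP.all? λ v → D.count (u , v) (face path) ≤? 1) u v
  ; E-loopless   = from-yes (FinP.all? λ v → D.∉? (v , v) (face path))
  }

schedule : List Move
schedule =
  (# 8 , # 5 , # 6) ∷ (# 4 , # 6 , # 8) ∷ (# 3 , # 6 , # 8) ∷ (# 2 , # 6 , # 8) ∷ (# 1 , # 6 , # 8) ∷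
  (# 4 , # 1 , # 2) ∷ (# 5 , # 1 , # 2) ∷ (# 3 , # 1 , # 5) ∷ (# 7 , # 1 , # 5) ∷ (# 7 , # 3 , # 4) ∷
  (# 9 , # 1 , # 6) ∷ (# 9 , # 4 , # 5) ∷ (# 9 , # 3 , # 7) ∷ (# 2 , # 7 , # 9) ∷ (# 0 , # 8 , # 9) ∷
  (# 0 , # 6 , # 7) ∷ (# 0 , # 4 , # 5) ∷ (# 0 , # 2 , # 3) ∷ []

K₁₀ : List (Dart 10)
K₁₀ = grow (face path) schedule

schedule-valid : Schedulable (face path) schedule
schedule-valid = from-yes (schedulable? (face path) schedule)

K₁₀-complete : ∀ u v → u ≢ v → (u , v) D.∈ K₁₀
K₁₀-complete u v u≢v = [ flip contradiction u≢v , id ]′ (loop-or-dart u v)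
  where
  loop-or-dart : ∀ u v → u ≡ v ⊎ (u , v) D.∈ K₁₀
  loop-or-dart = from-yes (FinP.all? λ u → FinP.all? λ v → (u ≟ v) ⊎-dec D.∈? (u , v) K₁₀)

K₁₀-regular : ∀ v → degree K₁₀ v ≡ 9
K₁₀-regular = from-yes (FinP.all? λ v → degree K₁₀ v ℕ.≟ 9)

cornerChoices : List ℕ
cornerChoices = radices (face path) schedule

embeddingAt : ℕ → Embedding
embeddingAt m = run schedule (digits cornerChoices m) path

embeddingAt-OneFace : ∀ m → m < product cornerChoices → OneFaceEmbedding pathHead K₁₀ (embeddingAt m)
embeddingAt-OneFace m m< = run-OneFace schedule path-OneFace schedule-valid (digits-bounded cornerChoices m<)

embeddingAt-injective : ∀ m m′ → m < product cornerChoices → m′ < product cornerChoices →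
                        (∀ v u → ρ (embeddingAt m) v u ≡ ρ (embeddingAt m′) v u) → m ≡ m′
embeddingAt-injective m m′ m< m′< same =
  digits-injective cornerChoices m< m′<
    (proj₂ (run-injective schedule path-OneFace path-OneFace schedule-valid
             (digits-bounded cornerChoices m<) (digits-bounded cornerChoices m′<)
             (order-determined (embeddingAt-OneFace m m<) (embeddingAt-OneFace m′ m′<) same)))

firstDart : Dart 10
firstDart = # 0 , # 1

firstDart-edge : proj₁ firstDart ≢ proj₂ firstDart
firstDart-edge ()

darts-10 : darts 10 ≡ firstDart ∷ drop 1 (darts 10)
darts-10 = refl

K₁₀-size : length K₁₀ ≤ 10 * 10
K₁₀-size = from-yes (length K₁₀ ≤? 10 * 10)

-- Only the first dart, of least key, can represent the single face.
faces≤1 : ∀ {head} S → OneFaceEmbedding head K₁₀ S → faces 10 (ρ S) ≤ 1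
faces≤1 S I =
  subst (λ ds → length (filterᵇ (isFaceRep (ρ S)) ds) ≤ 1) (sym darts-10)
    (length-filterᵇ≤1 (isFaceRep (ρ S)) firstDart (drop 1 (darts 10)) (All.map (λ {d} → notRep d) later))
  where
  later : All (λ d → proj₁ d ≢ proj₂ d × dartKey firstDart < dartKey d) (drop 1 (darts 10))
  later = from-yes (All.all? (λ d → ¬? (proj₁ d ≟ proj₂ d) ×-dec (dartKey firstDart <? dartKey d))
                             (drop 1 (darts 10)))
  notRep : ∀ d → proj₁ d ≢ proj₂ d × dartKey firstDart < dartKey d → isFaceRep (ρ S) d ≡ false
  notRep d (d-edge , key<) =
    Complete.notFaceRep I K₁₀-complete K₁₀-regular d firstDart d-edge firstDart-edge key< K₁₀-size

genus-bound : ∀ R → genus 10 R ≤ 18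
genus-bound R = /-monoˡ-≤ 2 (m∸n≤m ((10 * (10 ∸ 1)) / 2 + 2 ∸ 10) (faces 10 R))

genus-one-face : ∀ R → faces 10 R ≤ 1 → genus 10 R ≡ 18
genus-one-face R = halve (faces 10 R)
  where
  halve : ∀ F → F ≤ 1 → ((10 * (10 ∸ 1)) / 2 + 2 ∸ 10 ∸ F) / 2 ≡ 18
  halve 0             _        = refl
  halve 1             _        = refl
  halve (suc (suc _)) (s≤s ())

isMaxGenus : ∀ {head} S → OneFaceEmbedding head K₁₀ S → IsMaxGenusEmbedding 10 (ρ S)
isMaxGenus S I =
  Complete.isRotationSystem I K₁₀-complete K₁₀-regular ,
  λ R′ _ → subst (genus 10 R′ ≤_) (sym (genus-one-face (ρ S) (faces≤1 S I))) (genus-bound R′)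

mainTheorem10 : AtLeastMaxGenusEmbeddings 10 ((2 ^ 52) * (3 ^ 15) * (5 ^ 7) * (7 ^ 6))
mainTheorem10 =
  ρ ∘ embeddingAt ∘ toℕ ,
  (λ t → isMaxGenus (embeddingAt (toℕ t)) (embeddingAt-OneFace (toℕ t) (index< t))) ,
  (λ t t′ same → FinP.toℕ-injective (embeddingAt-injective (toℕ t) (toℕ t′) (index< t) (index< t′) same))
  where
  index< : ∀ (t : Fin ((2 ^ 52) * (3 ^ 15) * (5 ^ 7) * (7 ^ 6))) → toℕ t < product cornerChoices
  index< t = <-≤-trans (FinP.toℕ<n t)
                       (from-yes ((2 ^ 52) * (3 ^ 15) * (5 ^ 7) * (7 ^ 6) ≤? product cornerChoices))
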